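{- The random sequences $(\tau(C_1'),\dots,\tau(C_n'))$ and $(U_1,\dots,U_n)$ have the same joint distribution.
   Context: Discrete growth process: fix $2n$ points on a circle labeled $1,\dots,2n$ clockwise. At step $1$, endpoint $1$ is paired with a uniformly random partner among the other $2n-1$ points. At each step $k\ge2$, a pair is chosen uniformly at random among the $\binom{2n-2k+2}{2}$ pairs of points unused by the first $k-1$ chords and joined. $C_k'$ is the set of the first $k$ chords. For a chord diagram $\mathcal{C}$ with endpoint set $\{i_1<\dots<i_{2k}\}\subseteq[2n]$, $\tau(\mathcal{C})$ is the diagram on $[2k]$ obtained by relabeling $i_t$ as $t$. Continuous growth process: start with a circle with no chords; at step $1$ a chord is drawn and one of its endpoints is marked as reference. After step $k$ the $2k$ endpoints divide the circle into $2k$ arcs; at step $k+1$ one of the $\binom{2k+1}{2}$ choices of two distinct arcs or one arc twice is chosen uniformly at random independently of the past and a new chord is added with endpoints in the chosen arcs (only relative order matters). $U_k$ is the diagram after step $k$ with endpoints labeled $1,\dots,2k$ clockwise from the reference endpoint. -}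

module Defs where

open import Data.Nat using (ℕ; zero; suc; _+_; _*_; _<ᵇ_; _≡ᵇ_)
import Data.Nat as ℕ
open import Data.Bool using (Bool; true; false; if_then_else_; not; _∨_)
open import Data.List using (List; []; _∷_; _++_; map; concatMap; filter; length; upTo; foldr)
open import Data.Bool.ListAction using (any)
open import Data.List.Properties using (≡-dec)
open import Data.Product using (_×_; _,_; proj₁; proj₂)
open import Data.Integer using (+_)
open import Data.Rational using (ℚ; _/_; 0ℚ; 1ℚ) renaming (_+_ to _+ℚ_; _*_ to _*ℚ_)
open import Relation.Nullary.Decidable using (does)

Dist : Set → Set
Dist A = List (ℚ × A)

return : {A : Set} → A → Dist A
return x = (1ℚ , x) ∷ []

_>>=_ : {A B : Set} → Dist A → (A → Dist B) → Dist B
d >>= f = concatMap (λ { (w , x) → map (λ { (v , y) → (w *ℚ v , y) }) (f x) }) d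

-- uniform distribution on the (listed, pairwise distinct) options
uniform : {A : Set} → List A → Dist A
uniform []           = []
uniform (x ∷ rest)   = map (λ y → (+ 1 / suc (length rest)) , y) (x ∷ rest)

-- A chord diagram on [2k] (points labelled 0,…,2k-1 clockwise) is
-- encoded by its partner list: entry t is the label of the partner of t.
Diagram : Set
Diagram = List ℕ

Prob : Dist (List Diagram) → List Diagram → ℚ
Prob d ds = foldr (λ { (w , x) acc → if does (≡-dec (≡-dec ℕ._≟_) x ds) then w +ℚ acc else acc }) 0ℚ d

Chords : Set
Chords = List (ℕ × ℕ)

range : ℕ → ℕ → List ℕ
range a b = filter (λ x → a ℕ.≤? x) (upTo b)

used : Chords → ℕ → Bool
used cs x = any (λ { (a , b) → (a ≡ᵇ x) ∨ (b ≡ᵇ x) }) cs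

partnerOf : Chords → ℕ → ℕ
partnerOf []             x = 0
partnerOf ((a , b) ∷ cs) x =
  if a ≡ᵇ x then b else if b ≡ᵇ x then a else partnerOf cs x

-- τ: relabel the endpoints (all < N) of a chord set by their rank,
-- producing the partner list of the resulting diagram on [2k].
τ : ℕ → Chords → Diagram
τ N cs = map (λ e → rank (partnerOf cs e)) ends
  where
  ends : List ℕ
  ends = filter (λ x → Data.Bool._≟_ (used cs x) true) (upTo N)
  rank : ℕ → ℕ
  rank x = length (filter (λ y → y ℕ.<? x) ends)

-- Discrete growth process (points 1,…,2n of the paper are 0,…,2n-1 here)

-- unordered pairs {i < j} of elements of an increasing list
pairs : List ℕ → List (ℕ × ℕ)
pairs []       = []
pairs (x ∷ xs) = map (λ y → (x , y)) xs ++ pairs xs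

unused : ℕ → Chords → List ℕ
unused N cs = filter (λ x → Data.Bool._≟_ (used cs x) false) (upTo N)

discreteLoop : ℕ → ℕ → Chords → Dist (List Diagram)
discreteLoop N zero    cs = return []
discreteLoop N (suc r) cs =
  uniform (pairs (unused N cs)) >>= λ c →
  discreteLoop N r (cs ++ c ∷ []) >>= λ rest →
  return (τ N (cs ++ c ∷ []) ∷ rest)

-- joint law of (τ(C'_1), …, τ(C'_n))
discrete : ℕ → Dist (List Diagram)
discrete zero    = return []
discrete (suc m) =
  uniform (map (λ y → (0 , y)) (range 1 N)) >>= λ c →
  discreteLoop N m (c ∷ []) >>= λ rest →
  return (τ N (c ∷ []) ∷ rest)
  where N = 2 * suc m

-- After step k, arc a (0 ≤ a < 2k) is the arc clockwise after point a.
-- A choice of two distinct arcs or one arc twice: pairs a ≤ b < 2k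
-- (there are binom(2k+1,2) of them).
arcChoices : ℕ → List (ℕ × ℕ)
arcChoices m = concatMap (λ a → map (λ b → (a , b)) (range a m)) (upTo m)

-- relabelling of old points after inserting new points into arcs a ≤ b
shift : ℕ → ℕ → ℕ → ℕ
shift a b p = p + (if a <ᵇ p then 1 else 0) + (if b <ᵇ p then 1 else 0)

addChord : ℕ × ℕ → Chords → Chords
addChord (a , b) cs =
  map (λ { (x , y) → (shift a b x , shift a b y) }) cs ++ (suc a , suc (suc b)) ∷ []

-- r remaining steps, current diagram cs on [2k] (reference point = 0)
continuousLoop : ℕ → ℕ → ℕ → Chords → Dist (List Diagram)
continuousLoop N zero    k cs = return []
continuousLoop N (suc r) k cs =
  uniform (arcChoices (2 * k)) >>= λ ab →
  continuousLoop N r (suc k) (addChord ab cs) >>= λ rest →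
  return (τ N (addChord ab cs) ∷ rest)

-- joint law of (U_1, …, U_n)
continuous : ℕ → Dist (List Diagram)
continuous zero    = return []
continuous (suc m) =
  continuousLoop N m 1 ((0 , 1) ∷ []) >>= λ rest →
  return (τ N ((0 , 1) ∷ []) ∷ rest)
  where N = 2 * suc m

-- A step of the discrete process only sees the relative order of the points already used. So fix
-- the diagram E of the chords drawn so far up to relabelling, and average the discrete process over
-- the positions 0 ∷ S of their endpoints, S a j-subset of {1, …, 2n − 1}. The next chord c is a
-- uniform pair of points outside 0 ∷ S; the pairs (S, c) correspond bijectively to the pairs (T, c)
-- with T = S ∪ c a (j + 2)-subset and c ⊆ T, and the positions a < b + 1 of c inside T are a pair
-- of arcs a ≤ b of E, i.e. a step of the continuous process. The count
-- C(2n − 1, j) · C(2n − j − 1, 2) = C(2n − 1, j + 2) · C(j + 2, 2) makes the uniform weights agree,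
-- and induction on the number of remaining steps gives equal expectations for every test function
-- of the sequence of diagrams.

module Submission where

open import Defs
open import Data.Bool using (true; false; T; if_then_else_)
import Data.Bool as Bool
open import Data.Bool.Properties using (T-∨; T-≡)
open import Data.Empty using (⊥; ⊥-elim)
open import Data.Integer using (+_)
import Data.Integer.Properties as ℤ
open import Data.List using (List; []; _∷_; _++_; map; concatMap; filter; length; upTo; applyUpTo)
import Data.List.Properties as List
open import Data.List.Properties using (≡-dec)
open import Data.List.Membership.Propositional using (_∈_; _∉_; find; lose)
import Data.List.Membership.Propositional.Properties as ∈
open import Data.List.Membership.Propositional.Properties.WithK using (unique∧set⇒bag)
open import Data.List.Relation.Binary.BagAndSetEquality using (∼bag⇒↭)
open import Data.List.Relation.Binary.Permutation.Propositional as ↭ using (_↭_)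
import Data.List.Relation.Binary.Permutation.Propositional.Properties as ↭
open import Data.List.Relation.Unary.All as All using (All; []; _∷_)
import Data.List.Relation.Unary.All.Properties as All
open import Data.List.Relation.Unary.AllPairs as AllPairs using (AllPairs; []; _∷_)
import Data.List.Relation.Unary.AllPairs.Properties as AllPairs
open import Data.List.Relation.Unary.Any using (here; there)
import Data.List.Relation.Unary.Any.Properties as Any
open import Data.List.Relation.Unary.Unique.Propositional using (Unique)
open import Data.Nat using (ℕ; zero; suc; _+_; _*_; _∸_; _≤_; _<_; z≤n; s≤s; _<ᵇ_; _≡ᵇ_)
import Data.Nat as ℕ
import Data.Nat.Properties as ℕ
import Data.Nat.Coprimality as Coprime
open import Data.List.Membership.DecPropositional ℕ._≟_ using (_∈?_)
open import Data.Nat.Combinatorics using (_C_; nC1≡n; nCk+nC[k+1]≡[n+1]C[k+1])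
open import Data.Nat.Tactic.RingSolver using (solve-∀)
open import Data.Product using (_×_; _,_; proj₁; proj₂; Σ-syntax)
import Data.Product.Properties as Product
open import Data.Rational using (ℚ; 0ℚ; 1ℚ; _/_; toℚᵘ) renaming (_+_ to _+ℚ_; _*_ to _*ℚ_)
import Data.Rational.Properties as ℚ
import Data.Rational.Unnormalised as ℚᵘ
import Data.Rational.Unnormalised.Properties as ℚᵘ
open import Data.Rational.Solver using (module +-*-Solver)
open import Data.Sum as Sum using (_⊎_; inj₁; inj₂)
open import Function using (_∘_; id; _⟨_⟩_)
open import Function.Bundles using (Equivalence; mk⇔)
open import Relation.Binary.Definitions using (tri<; tri≈; tri>)
open import Relation.Binary.PropositionalEquality
open import Relation.Nullary using (¬_; yes; no; ¬?; does)
open import Relation.Unary using (Decidable)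

open ≡-Reasoning

∑ : {A : Set} → List A → (A → ℚ) → ℚ
∑ []       f = 0ℚ
∑ (x ∷ xs) f = f x +ℚ ∑ xs f

sigma : {A B : Set} → List A → (A → List B) → List (A × B)
sigma xs ys = concatMap (λ x → map (x ,_) (ys x)) xs

∑-++ : {A : Set} (xs ys : List A) (f : A → ℚ) → ∑ (xs ++ ys) f ≡ ∑ xs f +ℚ ∑ ys f
∑-++ []       ys f = sym (ℚ.+-identityˡ _)
∑-++ (x ∷ xs) ys f = trans (cong (f x +ℚ_) (∑-++ xs ys f)) (sym (ℚ.+-assoc (f x) _ _))

∑-map : {A B : Set} (g : A → B) (xs : List A) (f : B → ℚ) → ∑ (map g xs) f ≡ ∑ xs (f ∘ g)
∑-map g []       f = refl
∑-map g (x ∷ xs) f = cong (f (g x) +ℚ_) (∑-map g xs f)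

∑-cong : {A : Set} (xs : List A) {f g : A → ℚ} → (∀ x → x ∈ xs → f x ≡ g x) → ∑ xs f ≡ ∑ xs g
∑-cong []       eq = refl
∑-cong (x ∷ xs) eq = cong₂ _+ℚ_ (eq x (here refl)) (∑-cong xs (λ y y∈xs → eq y (there y∈xs)))

*-distribˡ-∑ : {A : Set} (c : ℚ) (xs : List A) (f : A → ℚ) → c *ℚ ∑ xs f ≡ ∑ xs (λ x → c *ℚ f x)
*-distribˡ-∑ c []       f = ℚ.*-zeroʳ c
*-distribˡ-∑ c (x ∷ xs) f =
  trans (ℚ.*-distribˡ-+ c (f x) (∑ xs f)) (cong (c *ℚ f x +ℚ_) (*-distribˡ-∑ c xs f))

∑-+ : {A : Set} (xs : List A) (f g : A → ℚ) → ∑ xs (λ x → f x +ℚ g x) ≡ ∑ xs f +ℚ ∑ xs g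
∑-+ []       f g = refl
∑-+ (x ∷ xs) f g = trans (cong (f x +ℚ g x +ℚ_) (∑-+ xs f g)) (interchange (f x) (g x) _ _)
  where
  open +-*-Solver
  interchange : (a b c d : ℚ) → (a +ℚ b) +ℚ (c +ℚ d) ≡ (a +ℚ c) +ℚ (b +ℚ d)
  interchange = solve 4 (λ a b c d → (a :+ b) :+ (c :+ d) := (a :+ c) :+ (b :+ d)) refl

∑-comm : {A B : Set} (xs : List A) (ys : List B) (f : A → B → ℚ) →
  ∑ xs (λ x → ∑ ys (f x)) ≡ ∑ ys (λ y → ∑ xs (λ x → f x y))
∑-comm []       ys f = sym (∑-zero ys)
  where
  ∑-zero : {B : Set} (ys : List B) → ∑ ys (λ _ → 0ℚ) ≡ 0ℚ
  ∑-zero []       = refl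
  ∑-zero (y ∷ ys) = trans (ℚ.+-identityˡ _) (∑-zero ys)
∑-comm (x ∷ xs) ys f =
  trans (cong (∑ ys (f x) +ℚ_) (∑-comm xs ys f)) (sym (∑-+ ys (f x) (λ y → ∑ xs (λ x → f x y))))

∑-sigma : {A B : Set} (xs : List A) (ys : A → List B) (f : A × B → ℚ) →
  ∑ (sigma xs ys) f ≡ ∑ xs (λ x → ∑ (ys x) (λ y → f (x , y)))
∑-sigma []       ys f = refl
∑-sigma (x ∷ xs) ys f =
  trans (∑-++ (map (x ,_) (ys x)) _ f) (cong₂ _+ℚ_ (∑-map (x ,_) (ys x) f) (∑-sigma xs ys f))

∑-↭ : {A : Set} {xs ys : List A} (f : A → ℚ) → xs ↭ ys → ∑ xs f ≡ ∑ ys f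
∑-↭ f ↭.refl         = refl
∑-↭ f (↭.prep x p)   = cong (f x +ℚ_) (∑-↭ f p)
∑-↭ f (↭.swap x y p) = trans (sym (ℚ.+-assoc (f x) (f y) _))
  (trans (cong₂ _+ℚ_ (ℚ.+-comm (f x) (f y)) (∑-↭ f p)) (ℚ.+-assoc (f y) (f x) _))
∑-↭ f (↭.trans p q)  = trans (∑-↭ f p) (∑-↭ f q)

fromℕ : ℕ → ℚ
fromℕ zero    = 0ℚ
fromℕ (suc n) = 1ℚ +ℚ fromℕ n

fromℕ-+ : (m n : ℕ) → fromℕ (m + n) ≡ fromℕ m +ℚ fromℕ n
fromℕ-+ zero    n = sym (ℚ.+-identityˡ (fromℕ n))
fromℕ-+ (suc m) n = trans (cong (1ℚ +ℚ_) (fromℕ-+ m n)) (sym (ℚ.+-assoc 1ℚ (fromℕ m) (fromℕ n)))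

fromℕ-* : (m n : ℕ) → fromℕ (m * n) ≡ fromℕ m *ℚ fromℕ n
fromℕ-* zero    n = sym (ℚ.*-zeroˡ (fromℕ n))
fromℕ-* (suc m) n = begin
  fromℕ (n + m * n)             ≡⟨ fromℕ-+ n (m * n) ⟩
  fromℕ n +ℚ fromℕ (m * n)       ≡⟨ cong₂ _+ℚ_ (sym (ℚ.*-identityˡ (fromℕ n))) (fromℕ-* m n) ⟩
  1ℚ *ℚ fromℕ n +ℚ fromℕ m *ℚ fromℕ n ≡⟨ sym (ℚ.*-distribʳ-+ (fromℕ n) 1ℚ (fromℕ m)) ⟩
  (1ℚ +ℚ fromℕ m) *ℚ fromℕ n      ∎

∑-const : {A : Set} (xs : List A) (c : ℚ) → ∑ xs (λ _ → c) ≡ fromℕ (length xs) *ℚ c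
∑-const []       c = sym (ℚ.*-zeroˡ c)
∑-const (x ∷ xs) c = begin
  c +ℚ ∑ xs (λ _ → c)               ≡⟨ cong₂ _+ℚ_ (sym (ℚ.*-identityˡ c)) (∑-const xs c) ⟩
  1ℚ *ℚ c +ℚ fromℕ (length xs) *ℚ c   ≡⟨ sym (ℚ.*-distribʳ-+ c 1ℚ (fromℕ (length xs))) ⟩
  fromℕ (suc (length xs)) *ℚ c      ∎

1/suc-*-fromℕ : (n : ℕ) → (+ 1 / suc n) *ℚ fromℕ (suc n) ≡ 1ℚ
1/suc-*-fromℕ n = ℚ.toℚᵘ-injective (ℚᵘ.≃-trans (ℚ.toℚᵘ-homo-* (+ 1 / suc n) (fromℕ (suc n)))
  (ℚᵘ.≃-trans (ℚᵘ.*-cong (ℚᵘ.≃-reflexive (cong toℚᵘ 1/suc-normalised)) (toℚᵘ-fromℕ (suc n)))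
              (ℚᵘ.*≡* (trans (ℤ.*-identityʳ _) (trans (ℤ.*-identityˡ (+ suc n))
                (sym (trans (ℤ.*-identityˡ _) (cong +_ (ℕ.*-identityʳ (suc n))))))))))
  where
  1/suc-normalised : + 1 / suc n ≡ Data.Rational.mkℚ (+ 1) n (Coprime.1-coprimeTo (suc n))
  1/suc-normalised = ℚ.normalize-coprime (Coprime.1-coprimeTo (suc n))
  toℚᵘ-fromℕ : (m : ℕ) → toℚᵘ (fromℕ m) ℚᵘ.≃ ℚᵘ.mkℚᵘ (+ m) 0
  toℚᵘ-fromℕ zero    = ℚᵘ.*≡* refl
  toℚᵘ-fromℕ (suc m) = ℚᵘ.≃-trans (ℚ.toℚᵘ-homo-+ 1ℚ (fromℕ m))
    (ℚᵘ.≃-trans (ℚᵘ.+-congʳ (toℚᵘ 1ℚ) (toℚᵘ-fromℕ m)) (ℚᵘ.*≡* (trans (ℤ.*-identityʳ _)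
      (trans (cong (Data.Integer._+_ (+ 1)) (ℤ.*-identityʳ (+ m))) (sym (ℤ.*-identityʳ (+ suc m)))))))

fromℕ-*-cancelˡ : ∀ {n} {x y : ℚ} → 0 < n → fromℕ n *ℚ x ≡ fromℕ n *ℚ y → x ≡ y
fromℕ-*-cancelˡ {suc n} {x} {y} _ eq = begin
  x                                     ≡⟨ sym (scaled-by-1 x) ⟩
  (+ 1 / suc n) *ℚ (fromℕ (suc n) *ℚ x) ≡⟨ cong ((+ 1 / suc n) *ℚ_) eq ⟩
  (+ 1 / suc n) *ℚ (fromℕ (suc n) *ℚ y) ≡⟨ scaled-by-1 y ⟩
  y                                     ∎
  where
  scaled-by-1 : (z : ℚ) → (+ 1 / suc n) *ℚ (fromℕ (suc n) *ℚ z) ≡ z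
  scaled-by-1 z = trans (sym (ℚ.*-assoc (+ 1 / suc n) (fromℕ (suc n)) z))
    (trans (cong (_*ℚ z) (1/suc-*-fromℕ n)) (ℚ.*-identityˡ z))

𝔼 : {A : Set} → Dist A → (A → ℚ) → ℚ
𝔼 d f = ∑ d (λ p → proj₁ p *ℚ f (proj₂ p))

𝔼-return : {A : Set} (x : A) (f : A → ℚ) → 𝔼 (return x) f ≡ f x
𝔼-return x f = trans (ℚ.+-identityʳ (1ℚ *ℚ f x)) (ℚ.*-identityˡ (f x))

𝔼-bind : {A B : Set} (d : Dist A) (k : A → Dist B) (f : B → ℚ) →
  𝔼 (d >>= k) f ≡ 𝔼 d (λ x → 𝔼 (k x) f)
𝔼-bind []            k f = refl
𝔼-bind {B = B} ((w , x) ∷ d) k f = begin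
  𝔼 (reweighted ++ (d >>= k)) f          ≡⟨ ∑-++ reweighted (d >>= k) _ ⟩
  𝔼 reweighted f +ℚ 𝔼 (d >>= k) f       ≡⟨ cong₂ _+ℚ_ (𝔼-reweight (k x)) (𝔼-bind d k f) ⟩
  w *ℚ 𝔼 (k x) f +ℚ 𝔼 d (λ x → 𝔼 (k x) f) ∎
  where
  reweighted = map (λ { (v , y) → (w *ℚ v , y) }) (k x)
  𝔼-reweight : (e : Dist B) → 𝔼 (map (λ { (v , y) → (w *ℚ v , y) }) e) f ≡ w *ℚ 𝔼 e f
  𝔼-reweight e = trans (∑-map _ e _)
    (trans (∑-cong e (λ p _ → ℚ.*-assoc w (proj₁ p) (f (proj₂ p))))
             (sym (*-distribˡ-∑ w e (λ p → proj₁ p *ℚ f (proj₂ p)))))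

fromℕ-length-*-𝔼-uniform : {A : Set} (xs : List A) (f : A → ℚ) →
  fromℕ (length xs) *ℚ 𝔼 (uniform xs) f ≡ ∑ xs f
fromℕ-length-*-𝔼-uniform []       f = refl
fromℕ-length-*-𝔼-uniform (x ∷ xs) f = begin
  fromℕ (suc ℓ) *ℚ 𝔼 (uniform (x ∷ xs)) f
    ≡⟨ cong (fromℕ (suc ℓ) *ℚ_) (∑-map (w ,_) (x ∷ xs) (λ p → proj₁ p *ℚ f (proj₂ p))) ⟩
  fromℕ (suc ℓ) *ℚ ∑ (x ∷ xs) (λ y → w *ℚ f y)
    ≡⟨ cong (fromℕ (suc ℓ) *ℚ_) (*-distribˡ-∑ w (x ∷ xs) f) ⟨
  fromℕ (suc ℓ) *ℚ (w *ℚ ∑ (x ∷ xs) f)   ≡⟨ ℚ.*-assoc (fromℕ (suc ℓ)) w _ ⟨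
  (fromℕ (suc ℓ) *ℚ w) *ℚ ∑ (x ∷ xs) f
    ≡⟨ cong (_*ℚ ∑ (x ∷ xs) f) (trans (ℚ.*-comm (fromℕ (suc ℓ)) w) (1/suc-*-fromℕ ℓ)) ⟩
  1ℚ *ℚ ∑ (x ∷ xs) f                     ≡⟨ ℚ.*-identityˡ _ ⟩
  ∑ (x ∷ xs) f                           ∎
  where
  ℓ = length xs
  w = + 1 / suc ℓ

𝔼-prepend : {A : Set} (d : Dist (List A)) (x : A) (g : List A → ℚ) →
  𝔼 (d >>= λ rest → return (x ∷ rest)) g ≡ 𝔼 d (g ∘ (x ∷_))
𝔼-prepend d x g = trans (𝔼-bind d (λ rest → return (x ∷ rest)) g)
  (∑-cong d (λ p _ → cong (proj₁ p *ℚ_) (𝔼-return (x ∷ proj₂ p) g)))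

fromℕ-length-*-𝔼-uniform-bind : {A B : Set} (xs : List A) (k : A → Dist B) (g : B → ℚ) →
  fromℕ (length xs) *ℚ 𝔼 (uniform xs >>= k) g ≡ ∑ xs (λ x → 𝔼 (k x) g)
fromℕ-length-*-𝔼-uniform-bind xs k g =
  trans (cong (fromℕ (length xs) *ℚ_) (𝔼-bind (uniform xs) k g)) (fromℕ-length-*-𝔼-uniform xs _)

indicator : List Diagram → List Diagram → ℚ
indicator ds x = if does (≡-dec (≡-dec ℕ._≟_) x ds) then 1ℚ else 0ℚ

Prob-≡-𝔼-indicator : (d : Dist (List Diagram)) (ds : List Diagram) → Prob d ds ≡ 𝔼 d (indicator ds)
Prob-≡-𝔼-indicator []            ds = refl
Prob-≡-𝔼-indicator ((w , x) ∷ d) ds with does (≡-dec (≡-dec ℕ._≟_) x ds)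
... | true  = cong₂ _+ℚ_ (sym (ℚ.*-identityʳ w)) (Prob-≡-𝔼-indicator d ds)
... | false = trans (Prob-≡-𝔼-indicator d ds)
  (trans (sym (ℚ.+-identityˡ _)) (cong (_+ℚ 𝔼 d (indicator ds)) (sym (ℚ.*-zeroʳ w))))

Increasing : List ℕ → Set
Increasing = AllPairs _<_

-- Out-of-range indices give the junk value 0.
nth : List ℕ → ℕ → ℕ
nth []       _       = 0
nth (x ∷ xs) zero    = x
nth (x ∷ xs) (suc i) = nth xs i

All-nth : {P : ℕ → Set} {xs : List ℕ} → All P xs → ∀ i → i < length xs → P (nth xs i)
All-nth (px ∷ _)   zero    _       = px
All-nth (_  ∷ pxs) (suc i) (s≤s i<) = All-nth pxs i i<

nth-∈ : (xs : List ℕ) (i : ℕ) → i < length xs → nth xs i ∈ xs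
nth-∈ (x ∷ xs) zero    _        = here refl
nth-∈ (x ∷ xs) (suc i) (s≤s i<) = there (nth-∈ xs i i<)

∈⇒nth : {x : ℕ} {xs : List ℕ} → x ∈ xs → Σ[ i ∈ ℕ ] i < length xs × nth xs i ≡ x
∈⇒nth (here refl) = 0 , s≤s z≤n , refl
∈⇒nth (there x∈)  with ∈⇒nth x∈
... | i , i< , eq = suc i , s≤s i< , eq

nth-monotone : {xs : List ℕ} → Increasing xs → ∀ {i j} → i < j → j < length xs → nth xs i < nth xs j
nth-monotone {x ∷ xs} (x< ∷ _)   {zero}  {suc j} _        (s≤s j<) = All-nth x< j j<
nth-monotone {x ∷ xs} (_  ∷ inc) {suc i} {suc j} (s≤s i<j) (s≤s j<) = nth-monotone inc i<j j<

nth-injective : {xs : List ℕ} → Increasing xs → ∀ {i j} → i < length xs → j < length xs →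
  nth xs i ≡ nth xs j → i ≡ j
nth-injective inc {i} {j} i< j< eq with ℕ.<-cmp i j
... | tri< i<j _ _ = ⊥-elim (ℕ.<⇒≢ (nth-monotone inc i<j j<) eq)
... | tri≈ _ i≡j _ = i≡j
... | tri> _ _ j<i = ⊥-elim (ℕ.<⇒≢ (nth-monotone inc j<i i<) (sym eq))

nth-applyUpTo : (f : ℕ → ℕ) (m i : ℕ) → i < m → nth (applyUpTo f m) i ≡ f i
nth-applyUpTo f (suc m) zero    _        = refl
nth-applyUpTo f (suc m) (suc i) (s≤s i<) = nth-applyUpTo (f ∘ suc) m i i<

nth-upTo : (m i : ℕ) → i < m → nth (upTo m) i ≡ i
nth-upTo = nth-applyUpTo id

map-nth-upTo : (xs : List ℕ) → map (nth xs) (upTo (length xs)) ≡ xs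
map-nth-upTo []       = refl
map-nth-upTo (x ∷ xs) = cong (x ∷_) (begin
  map (nth (x ∷ xs)) (applyUpTo suc (length xs)) ≡⟨ List.map-applyUpTo suc (nth (x ∷ xs)) (length xs) ⟩
  applyUpTo (nth xs) (length xs)                 ≡⟨ List.map-applyUpTo id (nth xs) (length xs) ⟨
  map (nth xs) (upTo (length xs))                ≡⟨ map-nth-upTo xs ⟩
  xs                                             ∎)

increasing-upTo : (m : ℕ) → Increasing (upTo m)
increasing-upTo m = AllPairs.applyUpTo⁺₁ id m (λ i<j _ → i<j)

rank-nth : {xs : List ℕ} → Increasing xs → ∀ i → i < length xs →
  length (filter (ℕ._<? nth xs i) xs) ≡ i
rank-nth {x ∷ xs} (x< ∷ _)   zero    _ = begin
  length (filter (ℕ._<? x) (x ∷ xs)) ≡⟨ cong length (List.filter-reject (ℕ._<? x) (ℕ.<-irrefl refl)) ⟩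
  length (filter (ℕ._<? x) xs)       ≡⟨ cong length (List.filter-none (ℕ._<? x) (All.map ℕ.<⇒≯ x<)) ⟩
  0                                  ∎
rank-nth {x ∷ xs} (x< ∷ inc) (suc i) (s≤s i<) =
  trans (cong length (List.filter-accept (ℕ._<? nth xs i) (All-nth x< i i<))) (cong suc (rank-nth inc i i<))

increasing-ext : {xs ys : List ℕ} → Increasing xs → Increasing ys →
  (∀ {z} → z ∈ xs → z ∈ ys) → (∀ {z} → z ∈ ys → z ∈ xs) → xs ≡ ys
increasing-ext {[]}     {[]}     _ _ _ _ = refl
increasing-ext {[]}     {y ∷ ys} _ _ _ ⊇ with () ← ⊇ (here refl)
increasing-ext {x ∷ xs} {[]}     _ _ ⊆ _ with () ← ⊆ (here refl)
increasing-ext {x ∷ xs} {y ∷ ys} (x< ∷ incx) (y< ∷ incy) ⊆ ⊇ with ⊆ (here refl) | ⊇ (here refl)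
... | here refl | _ = cong (x ∷_) (increasing-ext incx incy (tail-⊆ x< y< ⊆) (tail-⊆ y< x< ⊇))
  where
  tail-⊆ : ∀ {a as bs} → All (a <_) as → All (a <_) bs → (∀ {z} → z ∈ a ∷ as → z ∈ a ∷ bs) →
    ∀ {z} → z ∈ as → z ∈ bs
  tail-⊆ a<as _ ⊆′ z∈ with ⊆′ (there z∈)
  ... | here refl = ⊥-elim (ℕ.<-irrefl refl (All.lookup a<as z∈))
  ... | there z∈′ = z∈′
... | there x∈ys | here refl = ⊥-elim (ℕ.<-irrefl refl (All.lookup y< x∈ys))
... | there x∈ys | there y∈xs = ⊥-elim (ℕ.<-asym (All.lookup y< x∈ys) (All.lookup x< y∈xs))

remove : ℕ → List ℕ → List ℕ
remove x = filter (λ y → ¬? (y ℕ.≟ x))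

∈-remove⁻ : ∀ x xs {z} → z ∈ remove x xs → z ∈ xs × z ≢ x
∈-remove⁻ x xs = ∈.∈-filter⁻ (λ y → ¬? (y ℕ.≟ x)) {xs = xs}

∈-remove⁺ : ∀ x {xs z} → z ∈ xs → z ≢ x → z ∈ remove x xs
∈-remove⁺ x = ∈.∈-filter⁺ (λ y → ¬? (y ℕ.≟ x))

increasing-remove : ∀ x {xs} → Increasing xs → Increasing (remove x xs)
increasing-remove x = AllPairs.filter⁺ (λ y → ¬? (y ℕ.≟ x))

remove-∉ : ∀ x xs → x ∉ xs → remove x xs ≡ xs
remove-∉ x xs x∉ =
  List.filter-all (λ y → ¬? (y ℕ.≟ x)) (All.tabulate λ z∈ z≡x → x∉ (subst (_∈ xs) z≡x z∈))

length-filter-+-length-filter-¬ : {P : ℕ → Set} (P? : Decidable P) (xs : List ℕ) →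
  length (filter P? xs) + length (filter (¬? ∘ P?) xs) ≡ length xs
length-filter-+-length-filter-¬ P? []       = refl
length-filter-+-length-filter-¬ P? (x ∷ xs) with does (P? x)
... | true  = cong suc (length-filter-+-length-filter-¬ P? xs)
... | false = trans (ℕ.+-suc _ _) (cong suc (length-filter-+-length-filter-¬ P? xs))

deleteAt : ℕ → List ℕ → List ℕ
deleteAt _       []       = []
deleteAt zero    (x ∷ xs) = xs
deleteAt (suc i) (x ∷ xs) = x ∷ deleteAt i xs

increasing-deleteAt : ∀ i {xs} → Increasing xs → Increasing (deleteAt i xs)
increasing-deleteAt i       {[]}     []         = []
increasing-deleteAt zero    {x ∷ xs} (_  ∷ inc) = inc
increasing-deleteAt (suc i) {x ∷ xs} (x< ∷ inc) = All-deleteAt i x< ∷ increasing-deleteAt i inc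
  where
  All-deleteAt : {P : ℕ → Set} → ∀ i {xs} → All P xs → All P (deleteAt i xs)
  All-deleteAt i       {[]}     []         = []
  All-deleteAt zero    {x ∷ xs} (_  ∷ pxs) = pxs
  All-deleteAt (suc i) {x ∷ xs} (px ∷ pxs) = px ∷ All-deleteAt i pxs

length-deleteAt : ∀ i xs → i < length xs → suc (length (deleteAt i xs)) ≡ length xs
length-deleteAt zero    (x ∷ xs) _        = refl
length-deleteAt (suc i) (x ∷ xs) (s≤s i<) = cong suc (length-deleteAt i xs i<)

remove-nth : ∀ {xs} → Increasing xs → ∀ i → i < length xs → remove (nth xs i) xs ≡ deleteAt i xs
remove-nth {x ∷ xs} (x< ∷ inc) zero _ =
  trans (List.filter-reject (λ y → ¬? (y ℕ.≟ x)) (λ x≢x → x≢x refl))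
        (remove-∉ x xs (λ x∈ → ℕ.<-irrefl refl (All.lookup x< x∈)))
remove-nth {x ∷ xs} (x< ∷ inc) (suc i) (s≤s i<) =
  trans (List.filter-accept (λ y → ¬? (y ℕ.≟ nth xs i)) (λ x≡ → ℕ.<-irrefl x≡ (All-nth x< i i<)))
        (cong (x ∷_) (remove-nth inc i i<))

length-remove : ∀ {x xs} → Increasing xs → x ∈ xs → suc (length (remove x xs)) ≡ length xs
length-remove {xs = xs} inc x∈ with ∈⇒nth x∈
... | i , i< , refl = trans (cong (suc ∘ length) (remove-nth inc i i<)) (length-deleteAt i xs i<)

unique-map : {A B : Set} (f : A → B) {xs : List A} →
  (∀ {x y} → x ∈ xs → y ∈ xs → f x ≡ f y → x ≡ y) → Unique xs → Unique (map f xs)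
unique-map f {[]}     inj []         = []
unique-map f {x ∷ xs} inj (x∉ ∷ uxs) =
  All.tabulate fx∉ ∷ unique-map f (λ x∈ y∈ → inj (there x∈) (there y∈)) uxs
  where
  fx∉ : ∀ {z} → z ∈ map f xs → f x ≢ z
  fx∉ z∈ fx≡z with ∈.∈-map⁻ f z∈
  ... | y , y∈ , refl = All.lookup x∉ y∈ (inj (here refl) (there y∈) fx≡z)

unique-++ : {A : Set} {xs ys : List A} → Unique xs → Unique ys →
  (∀ {z} → z ∈ xs → z ∈ ys → ⊥) → Unique (xs ++ ys)
unique-++ uxs uys disjoint =
  AllPairs.++⁺ uxs uys
    (All.tabulate λ x∈ → All.tabulate λ y∈ x≡y → disjoint x∈ (subst (_∈ _) (sym x≡y) y∈))

increasing⇒unique : ∀ {xs} → Increasing xs → Unique xs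
increasing⇒unique = AllPairs.map ℕ.<⇒≢

∈-sigma⁻ : {A B : Set} (xs : List A) (ys : A → List B) {x : A} {y : B} →
  (x , y) ∈ sigma xs ys → x ∈ xs × y ∈ ys x
∈-sigma⁻ (a ∷ xs) ys p∈ with ∈.∈-++⁻ (map (a ,_) (ys a)) p∈
... | inj₁ p∈ˡ with ∈.∈-map⁻ (a ,_) p∈ˡ
...   | _ , y∈ , refl = here refl , y∈
∈-sigma⁻ (a ∷ xs) ys p∈ | inj₂ p∈ʳ with ∈-sigma⁻ xs ys p∈ʳ
... | x∈ , y∈ = there x∈ , y∈

∈-sigma⁺ : {A B : Set} (ys : A → List B) {xs : List A} {x : A} {y : B} →
  x ∈ xs → y ∈ ys x → (x , y) ∈ sigma xs ys
∈-sigma⁺ ys {a ∷ xs} (here refl) y∈ = ∈.∈-++⁺ˡ (∈.∈-map⁺ (a ,_) y∈)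
∈-sigma⁺ ys {a ∷ xs} (there x∈)  y∈ = ∈.∈-++⁺ʳ (map (a ,_) (ys a)) (∈-sigma⁺ ys x∈ y∈)

unique-sigma : {A B : Set} (ys : A → List B) {xs : List A} → Unique xs →
  (∀ x → x ∈ xs → Unique (ys x)) → Unique (sigma xs ys)
unique-sigma ys {[]}     []         _   = []
unique-sigma ys {x ∷ xs} (x∉ ∷ uxs) uys = unique-++
  (unique-map (x ,_) (λ _ _ → Product.,-injectiveʳ) (uys x (here refl)))
  (unique-sigma ys uxs (λ y y∈ → uys y (there y∈)))
  disjoint
  where
  disjoint : ∀ {p} → p ∈ map (x ,_) (ys x) → p ∈ sigma xs ys → ⊥
  disjoint p∈ˡ p∈ʳ with ∈.∈-map⁻ (x ,_) p∈ˡ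
  ... | _ , _ , refl = All.lookup x∉ (proj₁ (∈-sigma⁻ xs ys p∈ʳ)) refl

length-sigma : {A B : Set} (xs : List A) (ys : A → List B) (c : ℕ) →
  (∀ x → x ∈ xs → length (ys x) ≡ c) → length (sigma xs ys) ≡ length xs * c
length-sigma []       ys c _     = refl
length-sigma (x ∷ xs) ys c const = begin
  length (map (x ,_) (ys x) ++ sigma xs ys)     ≡⟨ List.length-++ (map (x ,_) (ys x)) ⟩
  length (map (x ,_) (ys x)) + length (sigma xs ys)
    ≡⟨ cong₂ _+_ (trans (List.length-map (x ,_) (ys x)) (const x (here refl)))
                 (length-sigma xs ys c (λ y y∈ → const y (there y∈))) ⟩
  c + length xs * c                             ∎

choose : ℕ → List ℕ → List (List ℕ)
choose zero    xs       = [] ∷ []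
choose (suc j) []       = []
choose (suc j) (x ∷ xs) = map (x ∷_) (choose j xs) ++ choose (suc j) xs

∈-choose⁻ : ∀ {xs} → Increasing xs → ∀ j {S} → S ∈ choose j xs →
  Increasing S × length S ≡ j × All (_∈ xs) S
∈-choose⁻ _ zero (here refl) = [] , refl , []
∈-choose⁻ {x ∷ xs} (x< ∷ inc) (suc j) S∈ with ∈.∈-++⁻ (map (x ∷_) (choose j xs)) S∈
... | inj₁ S∈ˡ with ∈.∈-map⁻ (x ∷_) S∈ˡ
...   | S′ , S′∈ , refl with ∈-choose⁻ inc j S′∈
...     | incS′ , lenS′ , S′⊆ =
  All.map (All.lookup x<) S′⊆ ∷ incS′ , cong suc lenS′ , here refl ∷ All.map there S′⊆
∈-choose⁻ {x ∷ xs} (x< ∷ inc) (suc j) S∈ | inj₂ S∈ʳ with ∈-choose⁻ inc (suc j) S∈ʳ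
... | incS , lenS , S⊆ = incS , lenS , All.map there S⊆

∈-choose⁺ : ∀ {xs S} → Increasing xs → Increasing S → All (_∈ xs) S → S ∈ choose (length S) xs
∈-choose⁺ {[]}    {[]} _ _ _ = here refl
∈-choose⁺ {_ ∷ _} {[]} _ _ _ = here refl
∈-choose⁺ {[]} {s ∷ S} _ _ (() ∷ _)
∈-choose⁺ {x ∷ xs} {s ∷ S} (x< ∷ inc) (s< ∷ incS) (here refl ∷ S⊆) =
  ∈.∈-++⁺ˡ (∈.∈-map⁺ (x ∷_) (∈-choose⁺ inc incS (All.zipWith drop-head (s< , S⊆))))
  where
  drop-head : ∀ {z} → s < z × z ∈ s ∷ xs → z ∈ xs
  drop-head (s<s , here refl) = ⊥-elim (ℕ.<-irrefl refl s<s)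
  drop-head (_   , there z∈)  = z∈
∈-choose⁺ {x ∷ xs} {s ∷ S} (x< ∷ inc) (s< ∷ incS) (there s∈ ∷ S⊆) =
  ∈.∈-++⁺ʳ (map (x ∷_) (choose (length S) xs))
    (∈-choose⁺ inc (s< ∷ incS) (s∈ ∷ All.zipWith drop-head (s< , S⊆)))
  where
  drop-head : ∀ {z} → s < z × z ∈ x ∷ xs → z ∈ xs
  drop-head (s<x , here refl) = ⊥-elim (ℕ.<-asym s<x (All.lookup x< s∈))
  drop-head (_   , there z∈)  = z∈

unique-choose : ∀ {xs} → Increasing xs → ∀ j → Unique (choose j xs)
unique-choose _ zero = [] ∷ []
unique-choose {[]} _ (suc j) = []
unique-choose {x ∷ xs} (x< ∷ inc) (suc j) = unique-++
  (unique-map (x ∷_) (λ _ _ → List.∷-injectiveʳ) (unique-choose inc j))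
  (unique-choose inc (suc j))
  disjoint
  where
  disjoint : ∀ {S} → S ∈ map (x ∷_) (choose j xs) → S ∈ choose (suc j) xs → ⊥
  disjoint S∈ˡ S∈ʳ with ∈.∈-map⁻ (x ∷_) S∈ˡ
  ... | _ , _ , refl with ∈-choose⁻ inc (suc j) S∈ʳ
  ...   | _ , _ , (x∈ ∷ _) = ℕ.<-irrefl refl (All.lookup x< x∈)

choose-1 : ∀ xs → choose 1 xs ≡ map (_∷ []) xs
choose-1 []       = refl
choose-1 (x ∷ xs) = cong ((x ∷ []) ∷_) (choose-1 xs)

∈-pairs⁻ : ∀ {xs} → Increasing xs → ∀ {a b} → (a , b) ∈ pairs xs → a ∈ xs × b ∈ xs × a < b
∈-pairs⁻ {x ∷ xs} (x< ∷ inc) p∈ with ∈.∈-++⁻ (map (x ,_) xs) p∈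
... | inj₁ p∈ˡ with ∈.∈-map⁻ (x ,_) p∈ˡ
...   | _ , b∈ , refl = here refl , there b∈ , All.lookup x< b∈
∈-pairs⁻ {x ∷ xs} (x< ∷ inc) p∈ | inj₂ p∈ʳ with ∈-pairs⁻ inc p∈ʳ
... | a∈ , b∈ , a<b = there a∈ , there b∈ , a<b

∈-pairs⁺ : ∀ {xs} → Increasing xs → ∀ {a b} → a ∈ xs → b ∈ xs → a < b → (a , b) ∈ pairs xs
∈-pairs⁺ {x ∷ xs} (x< ∷ inc) (here refl) (here refl) a<b = ⊥-elim (ℕ.<-irrefl refl a<b)
∈-pairs⁺ {x ∷ xs} (x< ∷ inc) (here refl) (there b∈)  a<b = ∈.∈-++⁺ˡ (∈.∈-map⁺ (x ,_) b∈)
∈-pairs⁺ {x ∷ xs} (x< ∷ inc) (there a∈)  (here refl) a<b = ⊥-elim (ℕ.<-asym a<b (All.lookup x< a∈))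
∈-pairs⁺ {x ∷ xs} (x< ∷ inc) (there a∈)  (there b∈)  a<b =
  ∈.∈-++⁺ʳ (map (x ,_) xs) (∈-pairs⁺ inc a∈ b∈ a<b)

unique-pairs : ∀ {xs} → Increasing xs → Unique (pairs xs)
unique-pairs {[]}     _          = []
unique-pairs {x ∷ xs} (x< ∷ inc) = unique-++
  (unique-map (x ,_) (λ _ _ → Product.,-injectiveʳ) (increasing⇒unique inc))
  (unique-pairs inc)
  disjoint
  where
  disjoint : ∀ {p} → p ∈ map (x ,_) xs → p ∈ pairs xs → ⊥
  disjoint p∈ˡ p∈ʳ with ∈.∈-map⁻ (x ,_) p∈ˡ
  ... | _ , _ , refl = ℕ.<-irrefl refl (All.lookup x< (proj₁ (∈-pairs⁻ inc p∈ʳ)))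

length-pairs : ∀ xs → length (pairs xs) ≡ length xs C 2
length-pairs []       = refl
length-pairs (x ∷ xs) = begin
  length (map (x ,_) xs ++ pairs xs)            ≡⟨ List.length-++ (map (x ,_) xs) ⟩
  length (map (x ,_) xs) + length (pairs xs)    ≡⟨ cong₂ _+_ (List.length-map (x ,_) xs) (length-pairs xs) ⟩
  length xs + length xs C 2                     ≡⟨ cong (_+ length xs C 2) (sym (nC1≡n (length xs))) ⟩
  length xs C 1 + length xs C 2                 ≡⟨ nCk+nC[k+1]≡[n+1]C[k+1] (length xs) 1 ⟩
  suc (length xs) C 2                           ∎

0<nC2 : ∀ {n} → 2 ≤ n → 0 < n C 2
0<nC2 {suc zero}    (s≤s ())
0<nC2 {suc (suc n)} _ = subst (0 <_) (nCk+nC[k+1]≡[n+1]C[k+1] (suc n) 1)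
  (subst (λ i → 0 < i + suc n C 2) (sym (nC1≡n (suc n))) (s≤s z≤n))

pairs-map : (f : ℕ → ℕ) (xs : List ℕ) →
  pairs (map f xs) ≡ map (λ p → (f (proj₁ p) , f (proj₂ p))) (pairs xs)
pairs-map f []       = refl
pairs-map f (x ∷ xs) =
  trans (cong₂ _++_ (trans (sym (List.map-∘ xs)) (List.map-∘ xs)) (pairs-map f xs))
        (sym (List.map-++ (λ p → (f (proj₁ p) , f (proj₂ p))) (map (x ,_) xs) (pairs xs)))

↭-from-members : {A : Set} {xs ys : List A} → Unique xs → Unique ys →
  (∀ {z} → z ∈ xs → z ∈ ys) → (∀ {z} → z ∈ ys → z ∈ xs) → xs ↭ ys
↭-from-members uxs uys ⊆ ⊇ = ∼bag⇒↭ (unique∧set⇒bag uxs uys (mk⇔ ⊆ ⊇))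

∈-range⁻ : ∀ {a m y} → y ∈ range a m → a ≤ y × y < m
∈-range⁻ {a} {m} y∈ with ∈.∈-filter⁻ (a ℕ.≤?_) {xs = upTo m} y∈
... | y∈upTo , a≤y = a≤y , ∈.∈-upTo⁻ y∈upTo

∈-range⁺ : ∀ {a m y} → a ≤ y → y < m → y ∈ range a m
∈-range⁺ {a} a≤y y<m = ∈.∈-filter⁺ (a ℕ.≤?_) (∈.∈-upTo⁺ y<m) a≤y

increasing-range : ∀ a m → Increasing (range a m)
increasing-range a m = AllPairs.filter⁺ (a ℕ.≤?_) (increasing-upTo m)

T-ext : ∀ {b c} → (T b → T c) → (T c → T b) → b ≡ c
T-ext {false} {false} _ _ = refl
T-ext {false} {true}  _ c⇒b with () ← c⇒b _
T-ext {true}  {false} b⇒c _ with () ← b⇒c _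
T-ext {true}  {true}  _ _ = refl

IsEnd : ℕ × ℕ → ℕ → Set
IsEnd c x = proj₁ c ≡ x ⊎ proj₂ c ≡ x

used⁻ : ∀ E {x} → T (used E x) → Σ[ c ∈ ℕ × ℕ ] c ∈ E × IsEnd c x
used⁻ E {x} usedx with find (Any.any⁻ _ E usedx)
... | c , c∈ , end = c , c∈ , Sum.map (ℕ.≡ᵇ⇒≡ _ x) (ℕ.≡ᵇ⇒≡ _ x) (Equivalence.to T-∨ end)

used⁺ : ∀ E {c x} → c ∈ E → IsEnd c x → T (used E x)
used⁺ E {c} {x} c∈ end =
  Any.any⁺ _ (lose c∈ (Equivalence.from T-∨ (Sum.map (ℕ.≡⇒≡ᵇ _ x) (ℕ.≡⇒≡ᵇ _ x) end)))

UsesExactly : ℕ → Chords → Set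
UsesExactly m E = ∀ x → used E x ≡ (x <ᵇ m)

used⇒< : ∀ {m} E → UsesExactly m E → ∀ {x} → T (used E x) → x < m
used⇒< {m} E uses {x} usedx = ℕ.<ᵇ⇒< x m (subst T (uses x) usedx)

<⇒used : ∀ {m} E → UsesExactly m E → ∀ {x} → x < m → T (used E x)
<⇒used E uses {x} x<m = subst T (sym (uses x)) (ℕ.<⇒<ᵇ x<m)

ChordsBelow : ℕ → Chords → Set
ChordsBelow m E = All (λ c → proj₁ c < m × proj₂ c < m) E

usesExactly⇒below : ∀ {m} E → UsesExactly m E → ChordsBelow m E
usesExactly⇒below E uses = All.tabulate λ c∈ →
  used⇒< E uses (used⁺ E c∈ (inj₁ refl)) , used⇒< E uses (used⁺ E c∈ (inj₂ refl))

mapEnds : (ℕ → ℕ) → Chords → Chords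
mapEnds f = map (λ c → (f (proj₁ c) , f (proj₂ c)))

used-mapEnds⁻ : ∀ f E {x} → T (used (mapEnds f E) x) →
  Σ[ c ∈ ℕ × ℕ ] c ∈ E × (f (proj₁ c) ≡ x ⊎ f (proj₂ c) ≡ x)
used-mapEnds⁻ f E usedx with used⁻ (mapEnds f E) usedx
... | _ , c′∈ , end with ∈.∈-map⁻ _ c′∈
...   | c , c∈ , refl = c , c∈ , end

used-mapEnds⁺ : ∀ f {E c e} → c ∈ E → IsEnd c e → T (used (mapEnds f E) (f e))
used-mapEnds⁺ f {E} c∈ end = used⁺ (mapEnds f E) (∈.∈-map⁺ _ c∈) (Sum.map (cong f) (cong f) end)

relabel : List ℕ → Chords → Chords
relabel pts = mapEnds (nth pts)

used-relabel⇒∈ : ∀ pts E → UsesExactly (length pts) E → ∀ {x} → T (used (relabel pts E) x) → x ∈ pts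
used-relabel⇒∈ pts E uses usedx with used-mapEnds⁻ (nth pts) E usedx | usesExactly⇒below E uses
... | c , c∈ , inj₁ refl | below = nth-∈ pts _ (proj₁ (All.lookup below c∈))
... | c , c∈ , inj₂ refl | below = nth-∈ pts _ (proj₂ (All.lookup below c∈))

∈⇒used-relabel : ∀ pts E → UsesExactly (length pts) E → ∀ {x} → x ∈ pts → T (used (relabel pts E) x)
∈⇒used-relabel pts E uses x∈ with ∈⇒nth x∈
... | i , i< , refl with used⁻ E (<⇒used E uses i<)
...   | c , c∈ , end = used-mapEnds⁺ (nth pts) {E} c∈ end

endpoints : ℕ → Chords → List ℕ
endpoints N cs = filter (λ x → used cs x Bool.≟ true) (upTo N)

∈-endpoints⁻ : ∀ {N cs x} → x ∈ endpoints N cs → x < N × T (used cs x)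
∈-endpoints⁻ {N} {cs} x∈ with ∈.∈-filter⁻ (λ x → used cs x Bool.≟ true) {xs = upTo N} x∈
... | x∈upTo , usedx = ∈.∈-upTo⁻ x∈upTo , Equivalence.from T-≡ usedx

∈-endpoints⁺ : ∀ {N cs x} → x < N → T (used cs x) → x ∈ endpoints N cs
∈-endpoints⁺ {N} {cs} x<N usedx =
  ∈.∈-filter⁺ (λ x → used cs x Bool.≟ true) (∈.∈-upTo⁺ x<N) (Equivalence.to T-≡ usedx)

endpoints-relabel : ∀ {N pts} E → Increasing pts → All (_< N) pts → UsesExactly (length pts) E →
  endpoints N (relabel pts E) ≡ pts
endpoints-relabel {N} {pts} E inc below uses = increasing-ext
  (AllPairs.filter⁺ (λ x → used (relabel pts E) x Bool.≟ true) (increasing-upTo N)) inc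
  (λ x∈ → used-relabel⇒∈ pts E uses (proj₂ (∈-endpoints⁻ {N} {relabel pts E} x∈)))
  (λ x∈ → ∈-endpoints⁺ {N} {relabel pts E} (All.lookup below x∈) (∈⇒used-relabel pts E uses x∈))

≡ᵇ-injective : ∀ (f : ℕ → ℕ) {e e′} → (f e ≡ f e′ → e ≡ e′) → (f e ≡ᵇ f e′) ≡ (e ≡ᵇ e′)
≡ᵇ-injective f {e} {e′} inj = T-ext
  (λ t → ℕ.≡⇒≡ᵇ e e′ (inj (ℕ.≡ᵇ⇒≡ (f e) (f e′) t)))
  (λ t → ℕ.≡⇒≡ᵇ (f e) (f e′) (cong f (ℕ.≡ᵇ⇒≡ e e′ t)))

-- f 0 ≡ 0 is needed only for the junk value 0 that partnerOf returns on an unmatched point.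
partnerOf-mapEnds : ∀ f {m} → f 0 ≡ 0 → (∀ {e e′} → e < m → e′ < m → f e ≡ f e′ → e ≡ e′) →
  ∀ E → ChordsBelow m E → ∀ {i} → i < m → partnerOf (mapEnds f E) (f i) ≡ f (partnerOf E i)
partnerOf-mapEnds f f0 inj []             _                  _   = sym f0
partnerOf-mapEnds f f0 inj ((a , b) ∷ E) ((a< , b<) ∷ below) {i} i<
  rewrite ≡ᵇ-injective f (inj a< i<) | ≡ᵇ-injective f (inj b< i<) with a ≡ᵇ i
... | true  = refl
... | false with b ≡ᵇ i
...   | true  = refl
...   | false = partnerOf-mapEnds f f0 inj E below i<

partnerOf-below : ∀ {m} E → ChordsBelow m E → 0 < m → ∀ i → partnerOf E i < m
partnerOf-below []             _                  0<m i = 0<m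
partnerOf-below ((a , b) ∷ E) ((a< , b<) ∷ below) 0<m i with a ≡ᵇ i
... | true  = b<
... | false with b ≡ᵇ i
...   | true  = a<
...   | false = partnerOf-below E below 0<m i

-- τ N cs unfolds to partnerRanks (endpoints N cs) cs.
partnerRanks : List ℕ → Chords → Diagram
partnerRanks ends cs = map (λ e → length (filter (ℕ._<? partnerOf cs e) ends)) ends

τ-relabel-partners : ∀ {N S m} E → Increasing (0 ∷ S) → All (_< N) (0 ∷ S) → suc (length S) ≡ m →
  UsesExactly m E → τ N (relabel (0 ∷ S) E) ≡ map (partnerOf E) (upTo m)
τ-relabel-partners {N} {S} E inc below refl uses = begin
  partnerRanks (endpoints N (relabel pts E)) (relabel pts E)
    ≡⟨ cong (λ ends → partnerRanks ends (relabel pts E)) (endpoints-relabel E inc below uses) ⟩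
  map rank pts                            ≡⟨ cong (map rank) (sym (map-nth-upTo pts)) ⟩
  map rank (map (nth pts) (upTo m))       ≡⟨ sym (List.map-∘ (upTo m)) ⟩
  map (rank ∘ nth pts) (upTo m)
    ≡⟨ List.map-cong-local (All.tabulate λ i∈ → rank-nth-partner (∈.∈-upTo⁻ i∈)) ⟩
  map (partnerOf E) (upTo m)              ∎
  where
  pts = 0 ∷ S
  m = suc (length S)
  rank : ℕ → ℕ
  rank e = length (filter (ℕ._<? partnerOf (relabel pts E) e) pts)
  below-E = usesExactly⇒below E uses
  rank-nth-partner : ∀ {i} → i < m → rank (nth pts i) ≡ partnerOf E i
  rank-nth-partner i< = trans
    (cong (λ p → length (filter (ℕ._<? p) pts))
          (partnerOf-mapEnds (nth pts) refl (λ e< e′< → nth-injective inc e< e′<) E below-E i<))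
    (rank-nth inc (partnerOf E _) (partnerOf-below E below-E (s≤s z≤n) _))

relabel-upTo : ∀ m E → ChordsBelow m E → relabel (upTo m) E ≡ E
relabel-upTo m E below = trans
  (List.map-cong-local (All.map (λ (e₁< , e₂<) → cong₂ _,_ (nth-upTo m _ e₁<) (nth-upTo m _ e₂<)) below))
  (List.map-id E)

τ-relabel : ∀ {N S m} E → Increasing (0 ∷ S) → All (_< N) (0 ∷ S) → suc (length S) ≡ m → m ≤ N →
  UsesExactly m E → τ N (relabel (0 ∷ S) E) ≡ τ N E
τ-relabel {N} {S} E inc below refl m≤N uses = begin
  τ N (relabel (0 ∷ S) E)                 ≡⟨ τ-relabel-partners E inc below refl uses ⟩
  map (partnerOf E) (upTo m)
    ≡⟨ τ-relabel-partners E (increasing-upTo m) upTo-below length-upTo uses ⟨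
  τ N (relabel (upTo m) E)                ≡⟨ cong (τ N) (relabel-upTo m E (usesExactly⇒below E uses)) ⟩
  τ N E                                   ∎
  where
  m = suc (length S)
  upTo-below : All (_< N) (upTo m)
  upTo-below = All.applyUpTo⁺₁ id m (λ i<m → ℕ.<-≤-trans i<m m≤N)
  length-upTo : suc (length (applyUpTo suc (length S))) ≡ m
  length-upTo = cong suc (List.length-applyUpTo suc (length S))

<ᵇ-true : ∀ {m n} → m < n → (m <ᵇ n) ≡ true
<ᵇ-true m<n = Equivalence.to T-≡ (ℕ.<⇒<ᵇ m<n)

<ᵇ-false : ∀ {m n} → n ≤ m → (m <ᵇ n) ≡ false
<ᵇ-false {m} {n} n≤m with m <ᵇ n in eq
... | false = refl
... | true  = ⊥-elim (ℕ.≤⇒≯ n≤m (ℕ.<ᵇ⇒< m n (Equivalence.from T-≡ eq)))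

skip : ℕ → ℕ → ℕ
skip i y = if y <ᵇ i then y else suc y

skip-below : ∀ {i y} → y < i → skip i y ≡ y
skip-below y<i rewrite <ᵇ-true y<i = refl

skip-above : ∀ {i y} → i ≤ y → skip i y ≡ suc y
skip-above i≤y rewrite <ᵇ-false i≤y = refl

skip-< : ∀ i {y m} → y < m → skip i y < suc m
skip-< i {y} y<m with y <ᵇ i
... | true  = ℕ.m<n⇒m<1+n y<m
... | false = s≤s y<m

skip-preimage : ∀ {i m x} → i ≤ m → x < suc m → x ≢ i → Σ[ y ∈ ℕ ] y < m × skip i y ≡ x
skip-preimage {i} {m} {x} i≤m x<1+m x≢i with x ℕ.<? i
... | yes x<i = x , ℕ.<-≤-trans x<i i≤m , skip-below x<i
... | no  x≮i with ℕ.≤∧≢⇒< (ℕ.≮⇒≥ x≮i) (x≢i ∘ sym)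
...   | i<x@(s≤s {n = y} i≤y) = y , ℕ.≤-pred x<1+m , skip-above i≤y

nth-deleteAt : ∀ i xs y → nth (deleteAt i xs) y ≡ nth xs (skip i y)
nth-deleteAt i       []       y with y <ᵇ i
... | true  = refl
... | false = refl
nth-deleteAt zero    (x ∷ xs) y       = refl
nth-deleteAt (suc i) (x ∷ xs) zero    = refl
nth-deleteAt (suc i) (x ∷ xs) (suc y) with y <ᵇ i | nth-deleteAt i xs y
... | true  | eq = eq
... | false | eq = eq

-- Inserting the two new endpoints into arcs a ≤ b leaves a gap at positions 1 + a and 2 + b.
shift≡skip∘skip : ∀ {a b} → a ≤ b → ∀ p → shift a b p ≡ skip (suc (suc b)) (skip (suc a) p)
shift≡skip∘skip {a} {b} a≤b p with ℕ.≤-<-connex p a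
... | inj₁ p≤a rewrite <ᵇ-false p≤a | <ᵇ-false (ℕ.≤-trans p≤a a≤b)
                     | skip-below {suc a} (s≤s p≤a)
                     | skip-below {suc (suc b)} (s≤s (ℕ.m≤n⇒m≤1+n (ℕ.≤-trans p≤a a≤b)))
                     = ℕ.+-identityʳ (p + 0) ⟨ trans ⟩ ℕ.+-identityʳ p
... | inj₂ a<p with ℕ.≤-<-connex p b
...   | inj₁ p≤b rewrite <ᵇ-true a<p | <ᵇ-false p≤b
                       | skip-above {suc a} a<p | skip-below {suc (suc b)} (s≤s (s≤s p≤b))
                       = ℕ.+-identityʳ (p + 1) ⟨ trans ⟩ ℕ.+-comm p 1
...   | inj₂ b<p rewrite <ᵇ-true a<p | <ᵇ-true b<p
                       | skip-above {suc a} a<p | skip-above {suc (suc b)} (s≤s b<p)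
                       = ℕ.+-assoc p 1 1 ⟨ trans ⟩ ℕ.+-comm p 2

shift-< : ∀ {a b m e} → a ≤ b → e < m → shift a b e < suc (suc m)
shift-< {a} {b} {m} {e} a≤b e<m rewrite shift≡skip∘skip a≤b e =
  skip-< (suc (suc b)) (skip-< (suc a) e<m)

shift-preimage : ∀ {a b m x} → a ≤ b → b < m → x < suc (suc m) → x ≢ suc a → x ≢ suc (suc b) →
  Σ[ e ∈ ℕ ] e < m × shift a b e ≡ x
shift-preimage {a} {b} {m} {x} a≤b b<m x< x≢1+a x≢2+b
  with skip-preimage {suc (suc b)} (s≤s b<m) x< x≢2+b
... | y , y<1+m , refl with skip-preimage {suc a} (ℕ.≤-trans (s≤s a≤b) b<m) y<1+m y≢1+a
  where
  y≢1+a : y ≢ suc a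
  y≢1+a refl = x≢1+a (skip-below (s≤s (s≤s a≤b)))
...   | e , e<m , refl = e , e<m , shift≡skip∘skip a≤b e

usesExactly-addChord : ∀ {m E a b} → UsesExactly m E → a ≤ b → b < m →
  UsesExactly (suc (suc m)) (addChord (a , b) E)
usesExactly-addChord {m} {E} {a} {b} uses a≤b b<m x =
  T-ext (λ usedx → ℕ.<⇒<ᵇ (used⇒bound usedx)) (λ x< → bound⇒used (ℕ.<ᵇ⇒< x _ x<))
  where
  new = (suc a , suc (suc b))
  below : ChordsBelow m E
  below = usesExactly⇒below E uses
  used⇒bound : T (used (addChord (a , b) E) x) → x < suc (suc m)
  used⇒bound usedx with used⁻ (addChord (a , b) E) usedx
  ... | c , c∈ , end with ∈.∈-++⁻ (mapEnds (shift a b) E) c∈ | end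
  ...   | inj₁ c∈ˡ | _ with ∈.∈-map⁻ _ c∈ˡ
  ...     | c₀ , c₀∈ , refl with end
  ...       | inj₁ refl = shift-< a≤b (proj₁ (All.lookup below c₀∈))
  ...       | inj₂ refl = shift-< a≤b (proj₂ (All.lookup below c₀∈))
  used⇒bound _ | _ | inj₂ (here refl) | inj₁ refl = s≤s (s≤s (ℕ.≤-trans a≤b (ℕ.<⇒≤ b<m)))
  used⇒bound _ | _ | inj₂ (here refl) | inj₂ refl = s≤s (s≤s b<m)
  new∈ : new ∈ addChord (a , b) E
  new∈ = ∈.∈-++⁺ʳ (mapEnds (shift a b) E) (here refl)
  bound⇒used : x < suc (suc m) → T (used (addChord (a , b) E) x)
  bound⇒used x< with x ℕ.≟ suc a | x ℕ.≟ suc (suc b)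
  ... | yes refl | _        = used⁺ (addChord (a , b) E) new∈ (inj₁ refl)
  ... | no _     | yes refl = used⁺ (addChord (a , b) E) new∈ (inj₂ refl)
  ... | no x≢1+a | no x≢2+b with shift-preimage a≤b b<m x< x≢1+a x≢2+b
  ...   | e , e<m , refl with used⁻ E (<⇒used E uses e<m)
  ...     | c₀ , c₀∈ , end = used⁺ (addChord (a , b) E) (∈.∈-++⁺ˡ (∈.∈-map⁺ _ c₀∈))
                               (Sum.map (cong (shift a b)) (cong (shift a b)) end)

removePair : ℕ × ℕ → List ℕ → List ℕ
removePair (c₁ , c₂) xs = remove c₁ (remove c₂ xs)

removePair-nth : ∀ {xs a b} → Increasing xs → a ≤ b → suc b < length xs →
  removePair (nth xs a , nth xs (suc b)) xs ≡ deleteAt a (deleteAt (suc b) xs)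
removePair-nth {xs} {a} {b} inc a≤b 1+b< = begin
  remove (nth xs a) (remove (nth xs (suc b)) xs)   ≡⟨ cong (remove (nth xs a)) (remove-nth inc (suc b) 1+b<) ⟩
  remove (nth xs a) (deleteAt (suc b) xs)          ≡⟨ cong (λ z → remove z (deleteAt (suc b) xs)) nth-a ⟩
  remove (nth xs′ a) xs′                           ≡⟨ remove-nth (increasing-deleteAt (suc b) inc) a a< ⟩
  deleteAt a xs′                                   ∎
  where
  xs′ = deleteAt (suc b) xs
  nth-a : nth xs a ≡ nth xs′ a
  nth-a = sym (trans (nth-deleteAt (suc b) xs a) (cong (nth xs) (skip-below (s≤s a≤b))))
  a< : a < length xs′
  a< = ℕ.≤-<-trans a≤b (ℕ.≤-pred (subst (suc b <_) (sym (length-deleteAt (suc b) xs 1+b<)) 1+b<))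

relabel-addChord : ∀ {pts a b} → Increasing pts → a ≤ b → suc b < length pts → ∀ E →
  relabel (0 ∷ removePair (nth pts a , nth pts (suc b)) pts) E ++ (nth pts a , nth pts (suc b)) ∷ []
    ≡ relabel (0 ∷ pts) (addChord (a , b) E)
relabel-addChord {pts} {a} {b} inc a≤b 1+b< E = begin
  relabel (0 ∷ removePair c pts) E ++ c ∷ []
    ≡⟨ cong (λ xs → relabel (0 ∷ xs) E ++ c ∷ []) (removePair-nth inc a≤b 1+b<) ⟩
  mapEnds (nth (0 ∷ deleteAt a (deleteAt (suc b) pts))) E ++ c ∷ []
    ≡⟨ cong (_++ c ∷ []) (List.map-cong (λ e → cong₂ _,_ (nth-shift (proj₁ e)) (nth-shift (proj₂ e))) E) ⟩
  mapEnds (nth (0 ∷ pts) ∘ shift a b) E ++ c ∷ []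
    ≡⟨ cong (_++ c ∷ []) (List.map-∘ E) ⟩
  relabel (0 ∷ pts) (mapEnds (shift a b) E) ++ c ∷ []
    ≡⟨ sym (List.map-++ _ (mapEnds (shift a b) E) ((suc a , suc (suc b)) ∷ [])) ⟩
  relabel (0 ∷ pts) (addChord (a , b) E) ∎
  where
  c = (nth pts a , nth pts (suc b))
  nth-shift : ∀ p → nth (0 ∷ deleteAt a (deleteAt (suc b) pts)) p ≡ nth (0 ∷ pts) (shift a b p)
  nth-shift p = begin
    nth (deleteAt (suc a) (deleteAt (suc (suc b)) (0 ∷ pts))) p
      ≡⟨ nth-deleteAt (suc a) (deleteAt (suc (suc b)) (0 ∷ pts)) p ⟩
    nth (deleteAt (suc (suc b)) (0 ∷ pts)) (skip (suc a) p)
      ≡⟨ nth-deleteAt (suc (suc b)) (0 ∷ pts) (skip (suc a) p) ⟩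
    nth (0 ∷ pts) (skip (suc (suc b)) (skip (suc a) p))
      ≡⟨ cong (nth (0 ∷ pts)) (shift≡skip∘skip a≤b p) ⟨
    nth (0 ∷ pts) (shift a b p)
      ∎

∈-removePair⁻ : ∀ c₁ c₂ xs {z} → z ∈ removePair (c₁ , c₂) xs → z ∈ xs × z ≢ c₁ × z ≢ c₂
∈-removePair⁻ c₁ c₂ xs z∈ with ∈-remove⁻ c₁ (remove c₂ xs) z∈
... | z∈′ , z≢c₁ with ∈-remove⁻ c₂ xs z∈′
...   | z∈xs , z≢c₂ = z∈xs , z≢c₁ , z≢c₂

∈-removePair⁺ : ∀ {c₁ c₂ xs z} → z ∈ xs → z ≢ c₁ → z ≢ c₂ → z ∈ removePair (c₁ , c₂) xs
∈-removePair⁺ {c₁} {c₂} z∈ z≢c₁ z≢c₂ = ∈-remove⁺ c₁ (∈-remove⁺ c₂ z∈ z≢c₂) z≢c₁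

increasing-removePair : ∀ c {xs} → Increasing xs → Increasing (removePair c xs)
increasing-removePair (c₁ , c₂) inc = increasing-remove c₁ (increasing-remove c₂ inc)

length-removePair : ∀ {c₁ c₂ xs} → Increasing xs → c₁ ∈ xs → c₂ ∈ xs → c₁ ≢ c₂ →
  suc (suc (length (removePair (c₁ , c₂) xs))) ≡ length xs
length-removePair {c₁} {c₂} {xs} inc c₁∈ c₂∈ c₁≢c₂ = trans
  (cong suc (length-remove (increasing-remove c₂ inc) (∈-remove⁺ c₂ c₁∈ c₁≢c₂)))
  (length-remove inc c₂∈)

removePair-injective : ∀ {c₁ c₂ xs ys} → Increasing xs → Increasing ys →
  c₁ ∈ xs → c₂ ∈ xs → c₁ ∈ ys → c₂ ∈ ys →
  removePair (c₁ , c₂) xs ≡ removePair (c₁ , c₂) ys → xs ≡ ys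
removePair-injective incx incy c₁∈x c₂∈x c₁∈y c₂∈y eq =
  increasing-ext incx incy (⊆ c₁∈y c₂∈y eq) (⊆ c₁∈x c₂∈x (sym eq))
  where
  ⊆ : ∀ {c₁ c₂ xs ys} → c₁ ∈ ys → c₂ ∈ ys → removePair (c₁ , c₂) xs ≡ removePair (c₁ , c₂) ys →
    ∀ {z} → z ∈ xs → z ∈ ys
  ⊆ {c₁} {c₂} c₁∈ c₂∈ eq {z} z∈ with z ℕ.≟ c₁ | z ℕ.≟ c₂
  ... | yes refl | _        = c₁∈
  ... | no _     | yes refl = c₂∈
  ... | no z≢c₁  | no z≢c₂  =
    proj₁ (∈-removePair⁻ c₁ c₂ _ (subst (z ∈_) eq (∈-removePair⁺ z∈ z≢c₁ z≢c₂)))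

∈-arcChoices⁻ : ∀ {m a b} → (a , b) ∈ arcChoices m → a ≤ b × b < m
∈-arcChoices⁻ {m} {a} ab∈ = ∈-range⁻ {a} {m} (proj₂ (∈-sigma⁻ (upTo m) (λ a → range a m) ab∈))

-- Arcs a ≤ b of a diagram with m endpoints correspond to points a < b + 1 of [m + 1].
nextRight : ℕ × ℕ → ℕ × ℕ
nextRight (a , b) = (a , suc b)

arcChoices↭pairs : ∀ m → map nextRight (arcChoices m) ↭ pairs (upTo (suc m))
arcChoices↭pairs m = ↭-from-members
  (unique-map nextRight
    (λ _ _ e → cong₂ _,_ (Product.,-injectiveˡ e) (ℕ.suc-injective (Product.,-injectiveʳ e)))
    (unique-sigma (λ a → range a m) (increasing⇒unique (increasing-upTo m))
                  (λ a _ → increasing⇒unique (increasing-range a m))))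
  (unique-pairs upTo⁺) to from
  where
  upTo⁺ : Increasing (upTo (suc m))
  upTo⁺ = increasing-upTo (suc m)
  to : ∀ {p} → p ∈ map nextRight (arcChoices m) → p ∈ pairs (upTo (suc m))
  to p∈ with ∈.∈-map⁻ nextRight p∈
  ... | (a , b) , ab∈ , refl with ∈-arcChoices⁻ ab∈
  ...   | a≤b , b<m =
    ∈-pairs⁺ upTo⁺ (∈.∈-upTo⁺ (s≤s (ℕ.≤-trans a≤b (ℕ.<⇒≤ b<m)))) (∈.∈-upTo⁺ (s≤s b<m)) (s≤s a≤b)
  from : ∀ {p} → p ∈ pairs (upTo (suc m)) → p ∈ map nextRight (arcChoices m)
  from {a , b} p∈ with ∈-pairs⁻ upTo⁺ p∈
  from {a , suc b} p∈ | _ , b+1∈ , s≤s a≤b = ∈.∈-map⁺ nextRight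
    (∈-sigma⁺ (λ a → range a m) (∈.∈-upTo⁺ (ℕ.≤-<-trans a≤b b<m)) (∈-range⁺ a≤b b<m))
    where
    b<m : b < m
    b<m = ℕ.≤-pred (∈.∈-upTo⁻ b+1∈)

∑-pairs-arcChoices : ∀ {m} pts → length pts ≡ suc m → (f : ℕ × ℕ → ℚ) →
  ∑ (pairs pts) f ≡ ∑ (arcChoices m) (λ (a , b) → f (nth pts a , nth pts (suc b)))
∑-pairs-arcChoices {m} pts len f = begin
  ∑ (pairs pts) f
    ≡⟨ cong (λ xs → ∑ (pairs xs) f) (map-nth-upTo pts) ⟨
  ∑ (pairs (map (nth pts) (upTo (length pts)))) f
    ≡⟨ cong (λ ps → ∑ ps f) (pairs-map (nth pts) (upTo (length pts))) ⟩
  ∑ (map nth² (pairs (upTo (length pts)))) f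
    ≡⟨ ∑-map nth² (pairs (upTo (length pts))) f ⟩
  ∑ (pairs (upTo (length pts))) (f ∘ nth²)
    ≡⟨ cong (λ n → ∑ (pairs (upTo n)) (f ∘ nth²)) len ⟩
  ∑ (pairs (upTo (suc m))) (f ∘ nth²)
    ≡⟨ ∑-↭ (f ∘ nth²) (arcChoices↭pairs m) ⟨
  ∑ (map nextRight (arcChoices m)) (f ∘ nth²)
    ≡⟨ ∑-map nextRight (arcChoices m) (f ∘ nth²) ⟩
  ∑ (arcChoices m) (λ (a , b) → f (nth pts a , nth pts (suc b))) ∎
  where
  nth² : ℕ × ℕ → ℕ × ℕ
  nth² (i , j) = (nth pts i , nth pts j)

length-arcChoices : ∀ m → length (arcChoices m) ≡ suc m C 2
length-arcChoices m = begin
  length (arcChoices m)                   ≡⟨ sym (List.length-map nextRight (arcChoices m)) ⟩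
  length (map nextRight (arcChoices m))   ≡⟨ ↭.↭-length (arcChoices↭pairs m) ⟩
  length (pairs (upTo (suc m)))           ≡⟨ length-pairs (upTo (suc m)) ⟩
  length (upTo (suc m)) C 2               ≡⟨ cong (_C 2) (List.length-upTo (suc m)) ⟩
  suc m C 2                               ∎

module Configurations (N : ℕ) where

  others : List ℕ
  others = range 1 N

  increasing-others : Increasing others
  increasing-others = increasing-range 1 N

  complement : List ℕ → List ℕ
  complement S = filter (λ x → ¬? (x ∈? 0 ∷ S)) (upTo N)

  ∈-complement⁻ : ∀ S {z} → z ∈ complement S → z < N × z ∉ 0 ∷ S
  ∈-complement⁻ S z∈ with ∈.∈-filter⁻ (λ x → ¬? (x ∈? 0 ∷ S)) {xs = upTo N} z∈
  ... | z∈upTo , z∉ = ∈.∈-upTo⁻ z∈upTo , z∉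

  ∈-complement⁺ : ∀ S {z} → z < N → z ∉ 0 ∷ S → z ∈ complement S
  ∈-complement⁺ S z<N z∉ = ∈.∈-filter⁺ (λ x → ¬? (x ∈? 0 ∷ S)) (∈.∈-upTo⁺ z<N) z∉

  increasing-complement : ∀ S → Increasing (complement S)
  increasing-complement S = AllPairs.filter⁺ (λ x → ¬? (x ∈? 0 ∷ S)) (increasing-upTo N)

  length-complement : ∀ S → Increasing (0 ∷ S) → All (_< N) (0 ∷ S) →
    suc (length S) + length (complement S) ≡ N
  length-complement S inc below = begin
    length (0 ∷ S) + length (complement S)
      ≡⟨ cong (λ xs → length xs + length (complement S)) (sym 0∷S≡filter) ⟩
    length (filter (_∈? 0 ∷ S) (upTo N)) + length (complement S)
      ≡⟨ length-filter-+-length-filter-¬ (_∈? 0 ∷ S) (upTo N) ⟩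
    length (upTo N)                       ≡⟨ List.length-upTo N ⟩
    N                                     ∎
    where
    0∷S≡filter : filter (_∈? 0 ∷ S) (upTo N) ≡ 0 ∷ S
    0∷S≡filter = increasing-ext (AllPairs.filter⁺ (_∈? 0 ∷ S) (increasing-upTo N)) inc
      (λ z∈ → proj₂ (∈.∈-filter⁻ (_∈? 0 ∷ S) {xs = upTo N} z∈))
      (λ z∈ → ∈.∈-filter⁺ (_∈? 0 ∷ S) (∈.∈-upTo⁺ (All.lookup below z∈)) z∈)

  ∈-choose-others⁻ : 0 < N → ∀ j {S} → S ∈ choose j others →
    Increasing (0 ∷ S) × All (_< N) (0 ∷ S) × length S ≡ j
  ∈-choose-others⁻ 0<N j S∈ with ∈-choose⁻ increasing-others j S∈
  ... | inc , len , S⊆ =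
    All.map (proj₁ ∘ ∈-range⁻ {1} {N}) S⊆ ∷ inc , 0<N ∷ All.map (proj₂ ∘ ∈-range⁻ {1} {N}) S⊆ , len

  Before : ℕ → List (List ℕ × (ℕ × ℕ))
  Before j = sigma (choose j others) (pairs ∘ complement)

  After : ℕ → List (List ℕ × (ℕ × ℕ))
  After j = sigma (choose (suc (suc j)) others) pairs

  forget : List ℕ × (ℕ × ℕ) → List ℕ × (ℕ × ℕ)
  forget (T , c) = (removePair c T , c)

  ∈-Before⁻ : ∀ j {S c₁ c₂} → (S , (c₁ , c₂)) ∈ Before j →
    S ∈ choose j others × c₁ ∈ complement S × c₂ ∈ complement S × c₁ < c₂
  ∈-Before⁻ j {S} x∈ with ∈-sigma⁻ (choose j others) (pairs ∘ complement) x∈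
  ... | S∈ , c∈ with ∈-pairs⁻ (increasing-complement S) c∈
  ...   | c₁∈ , c₂∈ , c₁<c₂ = S∈ , c₁∈ , c₂∈ , c₁<c₂

  ∈-Before⁺ : ∀ j {S c₁ c₂} → S ∈ choose j others → c₁ ∈ complement S → c₂ ∈ complement S →
    c₁ < c₂ → (S , (c₁ , c₂)) ∈ Before j
  ∈-Before⁺ j {S} S∈ c₁∈ c₂∈ c₁<c₂ =
    ∈-sigma⁺ (pairs ∘ complement) S∈ (∈-pairs⁺ (increasing-complement S) c₁∈ c₂∈ c₁<c₂)

  ∈-After⁻ : ∀ j {T c₁ c₂} → (T , (c₁ , c₂)) ∈ After j →
    T ∈ choose (suc (suc j)) others × c₁ ∈ T × c₂ ∈ T × c₁ < c₂
  ∈-After⁻ j x∈ with ∈-sigma⁻ (choose (suc (suc j)) others) pairs x∈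
  ... | T∈ , c∈ with ∈-pairs⁻ (proj₁ (∈-choose⁻ increasing-others (suc (suc j)) T∈)) c∈
  ...   | c₁∈ , c₂∈ , c₁<c₂ = T∈ , c₁∈ , c₂∈ , c₁<c₂

  ∈-After⁺ : ∀ j {T c₁ c₂} → T ∈ choose (suc (suc j)) others → c₁ ∈ T → c₂ ∈ T → c₁ < c₂ →
    (T , (c₁ , c₂)) ∈ After j
  ∈-After⁺ j T∈ c₁∈ c₂∈ c₁<c₂ =
    ∈-sigma⁺ pairs T∈ (∈-pairs⁺ (proj₁ (∈-choose⁻ increasing-others (suc (suc j)) T∈)) c₁∈ c₂∈ c₁<c₂)

  forget-After⊆Before : ∀ j {x} → x ∈ After j → forget x ∈ Before j
  forget-After⊆Before j {T , (c₁ , c₂)} x∈ with ∈-After⁻ j x∈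
  ... | T∈ , c₁∈ , c₂∈ , c₁<c₂ with ∈-choose⁻ increasing-others (suc (suc j)) T∈
  ...   | incT , lenT , T⊆ = ∈-Before⁺ j S∈
    (in-complement c₁∈ (proj₁ ∘ proj₂ ∘ ∈-removePair⁻ c₁ c₂ T))
    (in-complement c₂∈ (proj₂ ∘ proj₂ ∘ ∈-removePair⁻ c₁ c₂ T)) c₁<c₂
    where
    S = removePair (c₁ , c₂) T
    length-S : length S ≡ j
    length-S = ℕ.suc-injective (ℕ.suc-injective
      (trans (length-removePair incT c₁∈ c₂∈ (ℕ.<⇒≢ c₁<c₂)) lenT))
    S∈ : S ∈ choose j others
    S∈ = subst (λ n → S ∈ choose n others) length-S
      (∈-choose⁺ increasing-others (increasing-removePair (c₁ , c₂) incT)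
                 (All.tabulate (λ z∈ → All.lookup T⊆ (proj₁ (∈-removePair⁻ c₁ c₂ T z∈)))))
    in-complement : ∀ {c} → c ∈ T → (∀ {z} → z ∈ S → z ≢ c) → c ∈ complement S
    in-complement c∈ removed with ∈-range⁻ {1} {N} (All.lookup T⊆ c∈)
    ... | 1≤c , c<N = ∈-complement⁺ S c<N
      λ { (here refl) → ℕ.<-irrefl refl 1≤c ; (there c∈S) → removed c∈S refl }

  Before⊆forget-After : ∀ j {x} → x ∈ Before j → x ∈ map forget (After j)
  Before⊆forget-After j {S , (c₁ , c₂)} x∈ with ∈-Before⁻ j x∈
  ... | S∈ , c₁∈ , c₂∈ , c₁<c₂
    with ∈-choose⁻ increasing-others j S∈ | ∈-complement⁻ S c₁∈ | ∈-complement⁻ S c₂∈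
  ...   | incS , lenS , S⊆ | c₁<N , c₁∉ | c₂<N , c₂∉ =
    subst (_∈ map forget (After j)) (cong (_, (c₁ , c₂)) removePair-S∪c)
      (∈.∈-map⁺ forget (∈-After⁺ j S∪c∈ c₁∈S∪c c₂∈S∪c c₁<c₂))
    where
    S∪c = filter (_∈? c₁ ∷ c₂ ∷ S) others
    incS∪c : Increasing S∪c
    incS∪c = AllPairs.filter⁺ (_∈? c₁ ∷ c₂ ∷ S) increasing-others
    ∈S∪c : ∀ {z} → z ∈ c₁ ∷ c₂ ∷ S → z ∈ others → z ∈ S∪c
    ∈S∪c z∈ z∈others = ∈.∈-filter⁺ (_∈? c₁ ∷ c₂ ∷ S) z∈others z∈
    new∈others : ∀ {c} → c < N → c ∉ 0 ∷ S → c ∈ others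
    new∈others {zero}  _   c∉ = ⊥-elim (c∉ (here refl))
    new∈others {suc _} c<N _  = ∈-range⁺ (s≤s z≤n) c<N
    c₁∈S∪c : c₁ ∈ S∪c
    c₁∈S∪c = ∈S∪c (here refl) (new∈others c₁<N c₁∉)
    c₂∈S∪c : c₂ ∈ S∪c
    c₂∈S∪c = ∈S∪c (there (here refl)) (new∈others c₂<N c₂∉)
    removePair-S∪c : removePair (c₁ , c₂) S∪c ≡ S
    removePair-S∪c = increasing-ext (increasing-removePair (c₁ , c₂) incS∪c) incS ⊆ ⊇
      where
      ⊆ : ∀ {z} → z ∈ removePair (c₁ , c₂) S∪c → z ∈ S
      ⊆ z∈ with ∈-removePair⁻ c₁ c₂ S∪c z∈
      ... | z∈S∪c , z≢c₁ , z≢c₂ with proj₂ (∈.∈-filter⁻ (_∈? c₁ ∷ c₂ ∷ S) {xs = others} z∈S∪c)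
      ...   | here z≡c₁         = ⊥-elim (z≢c₁ z≡c₁)
      ...   | there (here z≡c₂) = ⊥-elim (z≢c₂ z≡c₂)
      ...   | there (there z∈S) = z∈S
      ⊇ : ∀ {z} → z ∈ S → z ∈ removePair (c₁ , c₂) S∪c
      ⊇ z∈S = ∈-removePair⁺ (∈S∪c (there (there z∈S)) (All.lookup S⊆ z∈S))
        (λ { refl → c₁∉ (there z∈S) }) (λ { refl → c₂∉ (there z∈S) })
    length-S∪c : length S∪c ≡ suc (suc j)
    length-S∪c = begin
      length S∪c
        ≡⟨ length-removePair incS∪c c₁∈S∪c c₂∈S∪c (ℕ.<⇒≢ c₁<c₂) ⟨
      suc (suc (length (removePair (c₁ , c₂) S∪c)))   ≡⟨ cong (suc ∘ suc ∘ length) removePair-S∪c ⟩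
      suc (suc (length S))                            ≡⟨ cong (suc ∘ suc) lenS ⟩
      suc (suc j)                                     ∎
    S∪c∈ : S∪c ∈ choose (suc (suc j)) others
    S∪c∈ = subst (λ n → S∪c ∈ choose n others) length-S∪c
      (∈-choose⁺ increasing-others incS∪c
        (All.tabulate (proj₁ ∘ ∈.∈-filter⁻ (_∈? c₁ ∷ c₂ ∷ S) {xs = others})))

  forget-injective : ∀ j {x y} → x ∈ After j → y ∈ After j → forget x ≡ forget y → x ≡ y
  forget-injective j {T , c} {T′ , c′} x∈ y∈ eq
    with Product.,-injectiveʳ eq | ∈-After⁻ j x∈ | ∈-After⁻ j y∈
  ... | refl | T∈ , c₁∈T , c₂∈T , _ | T′∈ , c₁∈T′ , c₂∈T′ , _ = cong (_, c)
    (removePair-injective (increasing T∈) (increasing T′∈) c₁∈T c₂∈T c₁∈T′ c₂∈T′ (Product.,-injectiveˡ eq))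
    where
    increasing : ∀ {U} → U ∈ choose (suc (suc j)) others → Increasing U
    increasing = proj₁ ∘ ∈-choose⁻ increasing-others (suc (suc j))

  Before↭After : ∀ j → Before j ↭ map forget (After j)
  Before↭After j = ↭-from-members
    (unique-sigma (pairs ∘ complement) (unique-choose increasing-others j)
                  (λ S _ → unique-pairs (increasing-complement S)))
    (unique-map forget (forget-injective j)
      (unique-sigma pairs (unique-choose increasing-others (suc (suc j)))
                    (λ T T∈ → unique-pairs (proj₁ (∈-choose⁻ increasing-others (suc (suc j)) T∈)))))
    (Before⊆forget-After j)
    forget-image
    where
    forget-image : ∀ {z} → z ∈ map forget (After j) → z ∈ Before j
    forget-image z∈ with ∈.∈-map⁻ forget z∈
    ... | x , x∈ , refl = forget-After⊆Before j x∈

  unused-relabel : ∀ {S m} E → Increasing (0 ∷ S) → suc (length S) ≡ m → UsesExactly m E →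
    unused N (relabel (0 ∷ S) E) ≡ complement S
  unused-relabel {S} E inc refl uses = increasing-ext
    (AllPairs.filter⁺ (λ x → used (relabel (0 ∷ S) E) x Bool.≟ false) (increasing-upTo N))
    (increasing-complement S) ⊆ ⊇
    where
    ⊆ : ∀ {z} → z ∈ unused N (relabel (0 ∷ S) E) → z ∈ complement S
    ⊆ z∈ with ∈.∈-filter⁻ (λ x → used (relabel (0 ∷ S) E) x Bool.≟ false) {xs = upTo N} z∈
    ... | z∈upTo , unusedz = ∈-complement⁺ S (∈.∈-upTo⁻ z∈upTo)
      (λ z∈0∷S → subst Bool.T unusedz (∈⇒used-relabel (0 ∷ S) E uses z∈0∷S))
    ⊇ : ∀ {z} → z ∈ complement S → z ∈ unused N (relabel (0 ∷ S) E)
    ⊇ {z} z∈ with ∈-complement⁻ S z∈ | used (relabel (0 ∷ S) E) z in usedz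
    ... | z<N , z∉ | false =
      ∈.∈-filter⁺ (λ x → used (relabel (0 ∷ S) E) x Bool.≟ false) (∈.∈-upTo⁺ z<N) usedz
    ... | z<N , z∉ | true  = ⊥-elim (z∉ (used-relabel⇒∈ (0 ∷ S) E uses (subst Bool.T (sym usedz) _)))

  length-pairs-complement : 0 < N → ∀ j {S} → S ∈ choose j others →
    length (pairs (complement S)) ≡ (N ∸ suc j) C 2
  length-pairs-complement 0<N j {S} S∈ with ∈-choose-others⁻ 0<N j S∈
  ... | inc , below , refl = trans (length-pairs (complement S)) (cong (_C 2) length-complement′)
    where
    length-complement′ : length (complement S) ≡ N ∸ suc (length S)
    length-complement′ = trans (sym (ℕ.m+n∸m≡n (suc (length S)) (length (complement S))))
                               (cong (_∸ suc (length S)) (length-complement S inc below))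

  length-choose-*-C2 : 0 < N → ∀ j →
    length (choose j others) * ((N ∸ suc j) C 2) ≡ length (choose (suc (suc j)) others) * (suc (suc j) C 2)
  length-choose-*-C2 0<N j = begin
    length (choose j others) * ((N ∸ suc j) C 2)
      ≡⟨ sym (length-sigma (choose j others) (pairs ∘ complement) _ (λ S → length-pairs-complement 0<N j)) ⟩
    length (Before j)                    ≡⟨ ↭.↭-length (Before↭After j) ⟩
    length (map forget (After j))        ≡⟨ List.length-map forget (After j) ⟩
    length (After j)
      ≡⟨ length-sigma (choose (suc (suc j)) others) pairs _ length-pairs-chosen ⟩
    length (choose (suc (suc j)) others) * (suc (suc j) C 2) ∎
    where
    length-pairs-chosen : ∀ T → T ∈ choose (suc (suc j)) others → length (pairs T) ≡ suc (suc j) C 2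
    length-pairs-chosen T T∈ = trans (length-pairs T)
      (cong (_C 2) (proj₁ (proj₂ (∈-choose⁻ increasing-others (suc (suc j)) T∈))))

module Averaging (N : ℕ) where
  open Configurations N

  continue : ℕ → (List Diagram → ℚ) → Chords → ℚ
  continue r g cs = 𝔼 (discreteLoop N r cs) (g ∘ (τ N cs ∷_))

  fromℕ-*-𝔼-discreteLoop-suc : 0 < N → ∀ r {j S} E (g : List Diagram → ℚ) → S ∈ choose j others →
    UsesExactly (suc j) E →
    fromℕ ((N ∸ suc j) C 2) *ℚ 𝔼 (discreteLoop N (suc r) (relabel (0 ∷ S) E)) g
      ≡ ∑ (pairs (complement S)) (λ c → continue r g (relabel (0 ∷ S) E ++ c ∷ []))
  fromℕ-*-𝔼-discreteLoop-suc 0<N r {j} {S} E g S∈ uses with ∈-choose-others⁻ 0<N j S∈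
  ... | inc , _ , refl = begin
    fromℕ ((N ∸ suc j) C 2) *ℚ 𝔼 (discreteLoop N (suc r) cs) g
      ≡⟨ cong (λ n → fromℕ n *ℚ 𝔼 (discreteLoop N (suc r) cs) g) (length-pairs-complement 0<N j S∈) ⟨
    fromℕ (length (pairs (complement S))) *ℚ 𝔼 (discreteLoop N (suc r) cs) g
      ≡⟨ cong (λ xs → fromℕ (length (pairs xs)) *ℚ 𝔼 (discreteLoop N (suc r) cs) g) (sym unused≡) ⟩
    fromℕ (length (pairs (unused N cs))) *ℚ 𝔼 (discreteLoop N (suc r) cs) g
      ≡⟨ fromℕ-length-*-𝔼-uniform-bind (pairs (unused N cs)) _ g ⟩
    ∑ (pairs (unused N cs))
      (λ c → 𝔼 (discreteLoop N r (cs ++ c ∷ []) >>= λ rest → return (τ N (cs ++ c ∷ []) ∷ rest)) g)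
      ≡⟨ ∑-cong (pairs (unused N cs)) (λ c _ → 𝔼-prepend (discreteLoop N r (cs ++ c ∷ [])) _ g) ⟩
    ∑ (pairs (unused N cs)) (λ c → continue r g (cs ++ c ∷ []))
      ≡⟨ cong (λ xs → ∑ (pairs xs) (λ c → continue r g (cs ++ c ∷ []))) unused≡ ⟩
    ∑ (pairs (complement S)) (λ c → continue r g (cs ++ c ∷ [])) ∎
    where
    cs = relabel (0 ∷ S) E
    unused≡ : unused N cs ≡ complement S
    unused≡ = unused-relabel E inc refl uses

  fromℕ-*-𝔼-continuousLoop-suc : ∀ r k E (g : List Diagram → ℚ) →
    fromℕ (length (arcChoices (2 * k))) *ℚ 𝔼 (continuousLoop N (suc r) k E) g
      ≡ ∑ (arcChoices (2 * k))
          (λ ab → 𝔼 (continuousLoop N r (suc k) (addChord ab E)) (g ∘ (τ N (addChord ab E) ∷_)))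
  fromℕ-*-𝔼-continuousLoop-suc r k E g =
    trans (fromℕ-length-*-𝔼-uniform-bind (arcChoices (2 * k)) _ g)
          (∑-cong (arcChoices (2 * k)) (λ ab _ → 𝔼-prepend (continuousLoop N r (suc k) (addChord ab E)) _ g))

  -- A pair c of points of T is a new chord inserted into a pair of arcs of E, relabelled along T.
  ∑-pairs-continue≡∑-arcChoices : 0 < N → ∀ r {k j T} E (g : List Diagram → ℚ) → 2 * k ≡ suc j →
    UsesExactly (suc j) E → suc (suc (suc j)) ≤ N → T ∈ choose (suc (suc j)) others →
    ∑ (pairs T) (λ c → continue r g (relabel (0 ∷ removePair c T) E ++ c ∷ []))
      ≡ ∑ (arcChoices (2 * k))
          (λ ab → 𝔼 (discreteLoop N r (relabel (0 ∷ T) (addChord ab E))) (g ∘ (τ N (addChord ab E) ∷_)))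
  ∑-pairs-continue≡∑-arcChoices 0<N r {k} {j} {T} E g 2k≡ uses room T∈
    with ∈-choose-others⁻ 0<N (suc (suc j)) T∈
  ... | inc@(_ ∷ incT) , below , lenT = trans
    (∑-pairs-arcChoices T (trans lenT (cong suc (sym 2k≡))) _)
    (∑-cong (arcChoices (2 * k)) (λ (a , b) ab∈ → continue-addChord a b (∈-arcChoices⁻ ab∈)))
    where
    continue-addChord : ∀ a b → a ≤ b × b < 2 * k →
      continue r g (relabel (0 ∷ removePair (nth T a , nth T (suc b)) T) E ++ (nth T a , nth T (suc b)) ∷ [])
        ≡ 𝔼 (discreteLoop N r (relabel (0 ∷ T) (addChord (a , b) E))) (g ∘ (τ N (addChord (a , b) E) ∷_))
    continue-addChord a b (a≤b , b<2k) = begin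
      continue r g (relabel (0 ∷ removePair c T) E ++ c ∷ [])
        ≡⟨ cong (continue r g) (relabel-addChord incT a≤b 1+b< E) ⟩
      continue r g (relabel (0 ∷ T) E′)
        ≡⟨ cong (λ d → 𝔼 (discreteLoop N r (relabel (0 ∷ T) E′)) (g ∘ (d ∷_))) τ≡ ⟩
      𝔼 (discreteLoop N r (relabel (0 ∷ T) E′)) (g ∘ (τ N E′ ∷_)) ∎
      where
      c = (nth T a , nth T (suc b))
      E′ = addChord (a , b) E
      b<1+j : b < suc j
      b<1+j = subst (b <_) 2k≡ b<2k
      1+b< : suc b < length T
      1+b< = subst (suc b <_) (sym lenT) (s≤s b<1+j)
      τ≡ : τ N (relabel (0 ∷ T) E′) ≡ τ N E′
      τ≡ = τ-relabel E′ inc below (cong suc lenT) room (usesExactly-addChord {E = E} uses a≤b b<1+j)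

  ∑-discreteLoop-suc : 0 < N → ∀ r {k j} E (g : List Diagram → ℚ) → 2 * k ≡ suc j → UsesExactly (suc j) E →
    suc (suc (suc j)) ≤ N →
    fromℕ ((N ∸ suc j) C 2) *ℚ ∑ (choose j others) (λ S → 𝔼 (discreteLoop N (suc r) (relabel (0 ∷ S) E)) g)
      ≡ ∑ (arcChoices (2 * k)) (λ ab → ∑ (choose (suc (suc j)) others)
            (λ T → 𝔼 (discreteLoop N r (relabel (0 ∷ T) (addChord ab E))) (g ∘ (τ N (addChord ab E) ∷_))))
  ∑-discreteLoop-suc 0<N r {k} {j} E g 2k≡ uses room = begin
    fromℕ p *ℚ ∑ Ch (λ S → 𝔼 (discreteLoop N (suc r) (relabel (0 ∷ S) E)) g)
      ≡⟨ *-distribˡ-∑ (fromℕ p) Ch _ ⟩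
    ∑ Ch (λ S → fromℕ p *ℚ 𝔼 (discreteLoop N (suc r) (relabel (0 ∷ S) E)) g)
      ≡⟨ ∑-cong Ch (λ S S∈ → fromℕ-*-𝔼-discreteLoop-suc 0<N r E g S∈ uses) ⟩
    ∑ Ch (λ S → ∑ (pairs (complement S)) (λ c → F (S , c)))
      ≡⟨ ∑-sigma Ch (pairs ∘ complement) F ⟨
    ∑ (Before j) F                   ≡⟨ ∑-↭ F (Before↭After j) ⟩
    ∑ (map forget (After j)) F       ≡⟨ ∑-map forget (After j) F ⟩
    ∑ (After j) (F ∘ forget)         ≡⟨ ∑-sigma Ch′ pairs (F ∘ forget) ⟩
    ∑ Ch′ (λ T → ∑ (pairs T) (λ c → F (forget (T , c))))
      ≡⟨ ∑-cong Ch′ (λ T T∈ → ∑-pairs-continue≡∑-arcChoices 0<N r {k} E g 2k≡ uses room T∈) ⟩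
    ∑ Ch′ (λ T → ∑ A (G T))          ≡⟨ ∑-comm Ch′ A G ⟩
    ∑ A (λ ab → ∑ Ch′ (λ T → G T ab)) ∎
    where
    Ch = choose j others
    Ch′ = choose (suc (suc j)) others
    A = arcChoices (2 * k)
    p = (N ∸ suc j) C 2
    F : List ℕ × (ℕ × ℕ) → ℚ
    F (S , c) = continue r g (relabel (0 ∷ S) E ++ c ∷ [])
    G : List ℕ → ℕ × ℕ → ℚ
    G T ab = 𝔼 (discreteLoop N r (relabel (0 ∷ T) (addChord ab E))) (g ∘ (τ N (addChord ab E) ∷_))

  private
    room-after-step : ∀ j r → suc j + 2 * suc r ≡ suc (suc (suc j)) + 2 * r
    room-after-step = solve-∀
    room-for-pair : ∀ {j r} → suc j + 2 * suc r ≤ N → 2 ≤ N ∸ suc j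
    room-for-pair {j} {r} room = ℕ.≤-trans (ℕ.m≤m*n 2 (suc r))
      (ℕ.m+n≤o⇒m≤o∸n (2 * suc r) (subst (_≤ N) (ℕ.+-comm (suc j) (2 * suc r)) room))
    rearrange : ∀ (M p M′ A : ℕ) (x : ℚ) → M * p ≡ M′ * A →
      fromℕ M′ *ℚ (fromℕ A *ℚ x) ≡ fromℕ p *ℚ (fromℕ M *ℚ x)
    rearrange M p M′ A x count = begin
      fromℕ M′ *ℚ (fromℕ A *ℚ x)   ≡⟨ ℚ.*-assoc (fromℕ M′) (fromℕ A) x ⟨
      (fromℕ M′ *ℚ fromℕ A) *ℚ x   ≡⟨ cong (_*ℚ x) (fromℕ-* M′ A) ⟨
      fromℕ (M′ * A) *ℚ x          ≡⟨ cong (λ n → fromℕ n *ℚ x) count ⟨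
      fromℕ (M * p) *ℚ x           ≡⟨ cong (_*ℚ x) (trans (fromℕ-* M p) (ℚ.*-comm (fromℕ M) (fromℕ p))) ⟩
      (fromℕ p *ℚ fromℕ M) *ℚ x    ≡⟨ ℚ.*-assoc (fromℕ p) (fromℕ M) x ⟩
      fromℕ p *ℚ (fromℕ M *ℚ x)    ∎

  ∑-discreteLoop≡continuousLoop : 0 < N → ∀ r {k j} E → 2 * k ≡ suc j → UsesExactly (suc j) E →
    suc j + 2 * r ≤ N → (g : List Diagram → ℚ) →
    ∑ (choose j others) (λ S → 𝔼 (discreteLoop N r (relabel (0 ∷ S) E)) g)
      ≡ fromℕ (length (choose j others)) *ℚ 𝔼 (continuousLoop N r k E) g
  ∑-discreteLoop≡continuousLoop 0<N zero {j = j} E _ _ _ g = begin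
    ∑ (choose j others) (λ S → 𝔼 (return []) g)
      ≡⟨ ∑-cong (choose j others) (λ _ _ → 𝔼-return [] g) ⟩
    ∑ (choose j others) (λ _ → g [])
      ≡⟨ ∑-const (choose j others) (g []) ⟩
    fromℕ (length (choose j others)) *ℚ g []
      ≡⟨ cong (fromℕ (length (choose j others)) *ℚ_) (𝔼-return [] g) ⟨
    fromℕ (length (choose j others)) *ℚ 𝔼 (return []) g
      ∎
  ∑-discreteLoop≡continuousLoop 0<N (suc r) {k} {j} E 2k≡ uses room g =
    fromℕ-*-cancelˡ (0<nC2 (room-for-pair room)) (begin
      fromℕ p *ℚ ∑ (choose j others) (λ S → 𝔼 (discreteLoop N (suc r) (relabel (0 ∷ S) E)) g)
        ≡⟨ ∑-discreteLoop-suc 0<N r {k} E g 2k≡ uses (ℕ.m+n≤o⇒m≤o _ room′) ⟩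
      ∑ A (λ ab → ∑ (choose (suc (suc j)) others)
                    (λ T → 𝔼 (discreteLoop N r (relabel (0 ∷ T) (addChord ab E))) (g′ ab)))
        ≡⟨ ∑-cong A (λ (a , b) ab∈ → IH a b (∈-arcChoices⁻ ab∈)) ⟩
      ∑ A (λ ab → fromℕ M′ *ℚ 𝔼 (continuousLoop N r (suc k) (addChord ab E)) (g′ ab))
        ≡⟨ *-distribˡ-∑ (fromℕ M′) A _ ⟨
      fromℕ M′ *ℚ ∑ A (λ ab → 𝔼 (continuousLoop N r (suc k) (addChord ab E)) (g′ ab))
        ≡⟨ cong (fromℕ M′ *ℚ_) (fromℕ-*-𝔼-continuousLoop-suc r k E g) ⟨
      fromℕ M′ *ℚ (fromℕ (length A) *ℚ 𝔼 (continuousLoop N (suc r) k E) g)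
        ≡⟨ rearrange (length (choose j others)) p M′ (length A) _ count ⟩
      fromℕ p *ℚ (fromℕ (length (choose j others)) *ℚ 𝔼 (continuousLoop N (suc r) k E) g) ∎)
    where
    M′ = length (choose (suc (suc j)) others)
    A = arcChoices (2 * k)
    p = (N ∸ suc j) C 2
    g′ : ℕ × ℕ → List Diagram → ℚ
    g′ ab = g ∘ (τ N (addChord ab E) ∷_)
    room′ : suc (suc (suc j)) + 2 * r ≤ N
    room′ = subst (_≤ N) (room-after-step j r) room
    IH : ∀ a b → a ≤ b × b < 2 * k →
      ∑ (choose (suc (suc j)) others)
        (λ T → 𝔼 (discreteLoop N r (relabel (0 ∷ T) (addChord (a , b) E))) (g′ (a , b)))
        ≡ fromℕ M′ *ℚ 𝔼 (continuousLoop N r (suc k) (addChord (a , b) E)) (g′ (a , b))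
    IH a b (a≤b , b<2k) = ∑-discreteLoop≡continuousLoop 0<N r (addChord (a , b) E)
      (trans (ℕ.*-suc 2 k) (cong (suc ∘ suc) 2k≡))
      (usesExactly-addChord {E = E} uses a≤b (subst (b <_) 2k≡ b<2k)) room′ (g′ (a , b))
    count : length (choose j others) * p ≡ M′ * length A
    count = trans (length-choose-*-C2 0<N j)
      (cong (M′ *_) (sym (trans (length-arcChoices (2 * k)) (cong (λ n → suc n C 2) 2k≡))))

firstChord : Chords
firstChord = (0 , 1) ∷ []

usesExactly-firstChord : UsesExactly 2 firstChord
usesExactly-firstChord zero          = refl
usesExactly-firstChord (suc zero)    = refl
usesExactly-firstChord (suc (suc x)) = refl

module FirstChord (m : ℕ) where
  N : ℕ
  N = 2 * suc m
  open Configurations N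

  2≤N : 2 ≤ N
  2≤N = ℕ.m≤m*n 2 (suc m)

  τ-firstChord : ∀ {y} → y ∈ others → τ N ((0 , y) ∷ []) ≡ τ N firstChord
  τ-firstChord y∈ with ∈-range⁻ {1} {N} y∈
  ... | 1≤y , y<N = τ-relabel firstChord ((1≤y ∷ []) ∷ [] ∷ []) (ℕ.<-≤-trans (s≤s z≤n) 2≤N ∷ y<N ∷ [])
    refl 2≤N usesExactly-firstChord

  fromℕ-*-𝔼-discrete : (g : List Diagram → ℚ) →
    fromℕ (length others) *ℚ 𝔼 (discrete (suc m)) g
      ≡ ∑ (choose 1 others)
          (λ S → 𝔼 (discreteLoop N m (relabel (0 ∷ S) firstChord)) (g ∘ (τ N firstChord ∷_)))
  fromℕ-*-𝔼-discrete g = begin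
    fromℕ (length others) *ℚ 𝔼 (discrete (suc m)) g
      ≡⟨ cong (λ n → fromℕ n *ℚ 𝔼 (discrete (suc m)) g) (List.length-map chordFrom0 others) ⟨
    fromℕ (length (map chordFrom0 others)) *ℚ 𝔼 (discrete (suc m)) g
      ≡⟨ fromℕ-length-*-𝔼-uniform-bind (map chordFrom0 others) _ g ⟩
    ∑ (map chordFrom0 others)
      (λ c → 𝔼 (discreteLoop N m (c ∷ []) >>= λ rest → return (τ N (c ∷ []) ∷ rest)) g)
      ≡⟨ ∑-map chordFrom0 others _ ⟩
    ∑ others (λ y → 𝔼 (discreteLoop N m ((0 , y) ∷ []) >>= λ rest → return (τ N ((0 , y) ∷ []) ∷ rest)) g)
      ≡⟨ ∑-cong others (λ y y∈ → trans (𝔼-prepend (discreteLoop N m ((0 , y) ∷ [])) _ g)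
           (cong (λ d → 𝔼 (discreteLoop N m ((0 , y) ∷ [])) (g ∘ (d ∷_))) (τ-firstChord y∈))) ⟩
    ∑ others (λ y → 𝔼 (discreteLoop N m (relabel (0 ∷ y ∷ []) firstChord)) g′)
      ≡⟨ ∑-map (_∷ []) others _ ⟨
    ∑ (map (_∷ []) others) (λ S → 𝔼 (discreteLoop N m (relabel (0 ∷ S) firstChord)) g′)
      ≡⟨ cong (λ Ch → ∑ Ch (λ S → 𝔼 (discreteLoop N m (relabel (0 ∷ S) firstChord)) g′)) (choose-1 others) ⟨
    ∑ (choose 1 others) (λ S → 𝔼 (discreteLoop N m (relabel (0 ∷ S) firstChord)) g′) ∎
    where
    g′ = g ∘ (τ N firstChord ∷_)
    chordFrom0 : ℕ → ℕ × ℕ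
    chordFrom0 y = (0 , y)

𝔼-discrete≡𝔼-continuous : ∀ n (g : List Diagram → ℚ) → 𝔼 (discrete n) g ≡ 𝔼 (continuous n) g
𝔼-discrete≡𝔼-continuous zero    g = refl
𝔼-discrete≡𝔼-continuous (suc m) g = fromℕ-*-cancelˡ 0<ℓ (begin
  fromℕ ℓ *ℚ 𝔼 (discrete (suc m)) g
    ≡⟨ fromℕ-*-𝔼-discrete g ⟩
  ∑ (choose 1 others) (λ S → 𝔼 (discreteLoop N m (relabel (0 ∷ S) firstChord)) g′)
    ≡⟨ Averaging.∑-discreteLoop≡continuousLoop N (s≤s z≤n) m firstChord refl usesExactly-firstChord
         (ℕ.≤-reflexive (sym (ℕ.*-suc 2 m))) g′ ⟩
  fromℕ (length (choose 1 others)) *ℚ 𝔼 (continuousLoop N m 1 firstChord) g′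
    ≡⟨ cong₂ _*ℚ_ (cong fromℕ (trans (cong length (choose-1 others)) (List.length-map (_∷ []) others)))
                  (sym (𝔼-prepend (continuousLoop N m 1 firstChord) (τ N firstChord) g)) ⟩
  fromℕ ℓ *ℚ 𝔼 (continuous (suc m)) g ∎)
  where
  open FirstChord m
  open Configurations N
  ℓ = length others
  g′ = g ∘ (τ N firstChord ∷_)
  0<ℓ : 0 < ℓ
  0<ℓ = ∈.∈-length (∈-range⁺ {1} {N} (s≤s z≤n) 2≤N)

mainTheorem19 : (n : ℕ) (ds : List Diagram) →
    Prob (discrete n) ds ≡ Prob (continuous n) ds
mainTheorem19 n ds = begin
  Prob (discrete n) ds             ≡⟨ Prob-≡-𝔼-indicator (discrete n) ds ⟩
  𝔼 (discrete n) (indicator ds)    ≡⟨ 𝔼-discrete≡𝔼-continuous n (indicator ds) ⟩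
  𝔼 (continuous n) (indicator ds)  ≡⟨ Prob-≡-𝔼-indicator (continuous n) ds ⟨
  Prob (continuous n) ds           ∎
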